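{- Let $M$ and $N$ be vertex-disjoint connected graphs, and let $T$ be a tree on $k\ge 2$ vertices such that $M$ and $T$ have exactly one common vertex $u$, and $T$ and $N$ have exactly one common vertex $v$ (and $T$ has no other vertices in common with $M$ or $N$). Let $G=M\cup T\cup N$. Let $G^*$ be the graph obtained from $M$ and $N$ by identifying $u$ and $v$ into a single vertex (still called $u$) and attaching $k-1$ new pendant vertices to $u$ (i.e. $k-1$ new vertices each adjacent only to $u$). (i) If $V(N)=\{v\}$ and $G\not\cong G^*$, then $D'(G)>D'(G^*)$. (ii) If $|V(M)|\ge 3$ and $|V(N)|\ge 3$, then $D'(G)>D'(G^*)$.
   Context: All graphs are finite, simple and connected. For a graph $G$, $d_G(x,y)$ denotes the distance between $x$ and $y$, $D_G(x)=\sum_{y\in V(G)}d_G(x,y)$, and $d_G(x)$ is the degree of $x$. The degree distance of $G$ is $D'(G)=\sum_{x\in V(G)}d_G(x)D_G(x)$. A pendant vertex is a vertex of degree one. -}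

module Defs where

open import Data.Nat using (ℕ; zero; suc; _≤_; _<_; _+_; _*_)
open import Data.Bool using (Bool; true; false; _∧_; _∨_; not; if_then_else_)
open import Data.Fin using (Fin; _≟_)
open import Data.Fin.Subset using (Subset; _∈_; ∣_∣)
open import Data.Vec using (lookup; tabulate)
open import Data.List using (List; []; _∷_; [_]; _++_; length; map; allFin)
open import Data.Nat.ListAction using (sum)
open import Data.Bool.ListAction using (any)
open import Data.List.Relation.Unary.All using (All)
open import Data.List.Relation.Unary.Unique.Propositional using (Unique)
open import Data.Product using (Σ; _×_; ∃)
open import Data.Sum using (_⊎_)
open import Data.Unit using (⊤)
open import Data.Empty using (⊥)
open import Relation.Nullary using (¬_)
open import Relation.Nullary.Decidable using (⌊_⌋)
open import Relation.Binary.PropositionalEquality using (_≡_)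
open import Function.Definitions using (Bijective)

Graph : ℕ → Set
Graph n = Fin n → Fin n → Bool

Adj : ∀ {n} → Graph n → Fin n → Fin n → Set
Adj A x y = A x y ≡ true

record Simple {n : ℕ} (A : Graph n) : Set where
  field
    symm    : ∀ x y → A x y ≡ A y x
    irrefl  : ∀ x → A x x ≡ false

-- walks staying inside a vertex set S (i.e. walks of the induced subgraph G[S])
data WalkIn {n : ℕ} (A : Graph n) (S : Subset n) : Fin n → Fin n → Set where
  here : ∀ {x} → x ∈ S → WalkIn A S x x
  step : ∀ {x y z} → x ∈ S → Adj A x z → WalkIn A S z y → WalkIn A S x y

ConnectedOn : ∀ {n} → Graph n → Subset n → Set
ConnectedOn {n} A S = (∃ λ x → x ∈ S) × (∀ x y → x ∈ S → y ∈ S → WalkIn A S x y)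

Chain : ∀ {n} → Graph n → List (Fin n) → Set
Chain A [] = ⊤
Chain A (x ∷ []) = ⊤
Chain A (x ∷ y ∷ r) = Adj A x y × Chain A (y ∷ r)

CycleIn : ∀ {n} → Graph n → Subset n → Fin n → List (Fin n) → Set
CycleIn A S x rest =
  (3 ≤ length (x ∷ rest)) × Unique (x ∷ rest) × All (_∈ S) (x ∷ rest)
  × Chain A (x ∷ rest ++ [ x ])

TreeOn : ∀ {n} → Graph n → Subset n → Set
TreeOn A S = ConnectedOn A S × (∀ x rest → ¬ CycleIn A S x rest)

walkOf : ∀ {n} → Graph n → ℕ → Fin n → Fin n → Bool
walkOf A zero x y = ⌊ x ≟ y ⌋
walkOf {n} A (suc k) x y = any (λ z → A x z ∧ walkOf A k z y) (allFin n)

searchDist : ∀ {n} → Graph n → Fin n → Fin n → ℕ → ℕ → ℕ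
searchDist A x y k zero = k
searchDist A x y k (suc f) = if walkOf A k x y then k else searchDist A x y (suc k) f

-- d_G(x,y): length of a shortest walk (= shortest path) from x to y.
-- (In a connected graph on n vertices this is < n, so the search bound n suffices.)
dist : ∀ {n} → Graph n → Fin n → Fin n → ℕ
dist {n} A x y = searchDist A x y 0 n

distSum : ∀ {n} → Graph n → Fin n → ℕ
distSum {n} A x = sum (map (dist A x) (allFin n))

deg : ∀ {n} → Graph n → Fin n → ℕ
deg A x = ∣ tabulate (A x) ∣

degreeDistance : ∀ {n} → Graph n → ℕ
degreeDistance {n} A = sum (map (λ x → deg A x * distSum A x) (allFin n))

Isomorphic : ∀ {n} → Graph n → Graph n → Set
Isomorphic {n} A B =
  Σ (Fin n → Fin n) λ f → Bijective _≡_ _≡_ f × (∀ x y → A x y ≡ B (f x) (f y))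

record Gluing {n : ℕ} (A : Graph n) : Set where
  field
    simple   : Simple A
    M T N    : Subset n
    u v      : Fin n
    u∈M      : u ∈ M
    u∈T      : u ∈ T
    v∈T      : v ∈ T
    v∈N      : v ∈ N
    cover    : ∀ x → x ∈ M ⊎ x ∈ T ⊎ x ∈ N
    M∩N      : ∀ x → x ∈ M → x ∈ N → ⊥
    M∩T      : ∀ x → x ∈ M → x ∈ T → x ≡ u
    T∩N      : ∀ x → x ∈ T → x ∈ N → x ≡ v
    edges    : ∀ x y → Adj A x y →
               (x ∈ M × y ∈ M) ⊎ (x ∈ T × y ∈ T) ⊎ (x ∈ N × y ∈ N)
    M-conn   : ConnectedOn A M
    N-conn   : ConnectedOn A N
    T-tree   : TreeOn A T
    k≥2      : 2 ≤ ∣ T ∣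

-- M is kept; N is kept with v identified
-- with u (so N' = N ∖ {v}, and v's N-edges become u's edges); the k-1
-- vertices of T ∖ {u} become pendant vertices attached to u.
gStar : ∀ {n} {A : Graph n} → Gluing A → Graph n
gStar {n} {A} g x y =
     (inM x ∧ inM y ∧ A x y)
  ∨ (inN' x ∧ inN' y ∧ A x y)
  ∨ (isU x ∧ inN' y ∧ A v y)
  ∨ (inN' x ∧ isU y ∧ A x v)
  ∨ (isU x ∧ inP y)
  ∨ (inP x ∧ isU y)
  where
    open Gluing g
    isU : Fin n → Bool
    isU z = ⌊ z ≟ u ⌋
    inM : Fin n → Bool
    inM z = lookup M z
    inN' : Fin n → Bool
    inN' z = lookup N z ∧ not ⌊ z ≟ v ⌋
    inP : Fin n → Bool
    inP z = lookup T z ∧ not (isU z)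

-- Write D'(G) as the sum, over ordered pairs (x , z) of adjacent vertices, of D(x). The edges of
-- G are those of M, of N and of T; the edges of G* are those of M, of N (with v renamed u) and
-- the k - 1 pendant edges at u. Distances from a vertex of M or of N ∖ {v} do not increase from
-- G to G*, and D*(u) ≤ D(v): each such inequality is read off a map G → G* that sends every edge
-- to an edge or contracts it. Orienting T towards u, every p ∈ T ∖ {u} has a parent q(p), the
-- edges p q(p) are the edges of T, and D*(u) + D*(p) ≤ D(p) + D(q(p)); this pays for the pendant
-- edge u p. In (ii) the inequality for D(u) is strict because u has a neighbour in M and N ∖ {v}
-- gets closer. In (i), N = {v}, and some pendant inequality is strict unless T is a star centred
-- at u, or M = {u} and T is a star centred at some c; in both cases G ≅ G*.
module Submission where

open import Defs
open import Data.Nat using (ℕ; zero; suc; _≤_; _<_; _+_; _*_; _∸_; z≤n; s≤s)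
  renaming (_≟_ to _≟ℕ_)
open import Data.Nat.Properties hiding (_≟_)
open import Data.Nat.Tactic.RingSolver using (solve-∀)
open import Data.Bool using (Bool; true; false; _∧_; _∨_; not; if_then_else_; _xor_)
import Data.Bool.Properties as Bool
open import Data.Fin using (Fin; zero; suc; _≟_; toℕ)
import Data.Fin.Properties as Fin
open import Data.Fin.Subset using (Subset; _∈_; ∣_∣)
open import Data.Vec using (lookup; tabulate)
open import Data.Vec.Properties using ([]=⇒lookup; lookup⇒[]=; tabulate∘lookup)
open import Data.List using ([]; _∷_; map; allFin)
import Data.List as List
open import Data.List.Properties using (map-tabulate)
open import Data.Nat.ListAction using () renaming (sum to sumᴸ)
open import Data.Bool.ListAction using (any)
open import Data.List.Relation.Unary.Any using (satisfied)
open import Data.List.Relation.Unary.Any.Properties using (any⁺; any⁻)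
open import Data.List.Membership.Propositional using (lose)
open import Data.List.Membership.Propositional.Properties using (∈-allFin)
open import Data.List.Relation.Unary.All using ([]; _∷_)
open import Data.List.Relation.Unary.AllPairs using ([]; _∷_)
open import Data.Product using (Σ; _×_; _,_; proj₁; proj₂)
open import Data.Sum using (_⊎_; inj₁; inj₂)
open import Data.Unit using (tt)
open import Data.Empty using (⊥; ⊥-elim)
open import Function using (_∘_; flip; mk⇔; Equivalence)
open Equivalence using (to; from)
open import Relation.Nullary using (¬_; yes; no; Dec)
open import Relation.Nullary.Decidable using (⌊_⌋; _×-dec_; ¬?; dec-true; dec-false; isYes≗does; ⌊⌋-map′)
open import Relation.Binary.PropositionalEquality

open import Algebra.Properties.Semiring.Sum +-*-semiring
  using (sum-cong-≗; sum-replicate-zero; ∑-distrib-+; ∑-comm; *-distribˡ-sum; *-distribʳ-sum)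
  renaming (sum to ∑)

⌊≟⌋-yes : ∀ {n} {x y : Fin n} → x ≡ y → ⌊ x ≟ y ⌋ ≡ true
⌊≟⌋-yes {x = x} {y} x≡y = trans (isYes≗does (x ≟ y)) (dec-true (x ≟ y) x≡y)

⌊≟⌋-no : ∀ {n} {x y : Fin n} → x ≢ y → ⌊ x ≟ y ⌋ ≡ false
⌊≟⌋-no {x = x} {y} x≢y = trans (isYes≗does (x ≟ y)) (dec-false (x ≟ y) x≢y)

⌊≟⌋-sound : ∀ {n} {x y : Fin n} → ⌊ x ≟ y ⌋ ≡ true → x ≡ y
⌊≟⌋-sound {x = x} {y} eq with x ≟ y
... | yes x≡y = x≡y

∧-intro : ∀ {a b : Bool} → a ≡ true → b ≡ true → (a ∧ b) ≡ true
∧-intro refl refl = refl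

∧-elimˡ : ∀ {a b : Bool} → (a ∧ b) ≡ true → a ≡ true
∧-elimˡ {true} _ = refl

∧-elimʳ : ∀ {a b : Bool} → (a ∧ b) ≡ true → b ≡ true
∧-elimʳ {true} eq = eq

∧-falseˡ : ∀ {a b} → a ≡ false → (a ∧ b) ≡ false
∧-falseˡ refl = refl

∨-introˡ : ∀ {a} b → a ≡ true → (a ∨ b) ≡ true
∨-introˡ b refl = refl

∨-introʳ : ∀ a {b} → b ≡ true → (a ∨ b) ≡ true
∨-introʳ true _ = refl
∨-introʳ false eq = eq

∨-elim : ∀ a {b} → (a ∨ b) ≡ true → a ≡ true ⊎ b ≡ true
∨-elim true _ = inj₁ refl
∨-elim false eq = inj₂ eq

true≢false : ∀ {b} → b ≡ true → b ≢ false
true≢false refl ()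

bool-cases : ∀ b → b ≡ true ⊎ b ≡ false
bool-cases true = inj₁ refl
bool-cases false = inj₂ refl

any-allFin-intro : ∀ {n} (p : Fin n → Bool) (z : Fin n) → p z ≡ true → any p (allFin n) ≡ true
any-allFin-intro p z pz = to Bool.T-≡ (any⁺ p (lose (∈-allFin z) (from Bool.T-≡ pz)))

any-allFin-elim : ∀ {n} (p : Fin n → Bool) → any p (allFin n) ≡ true → Σ (Fin n) (λ z → p z ≡ true)
any-allFin-elim {n} p found with satisfied (any⁻ p (allFin n) (from Bool.T-≡ found))
... | z , pz = z , to Bool.T-≡ pz

bool-≡ : ∀ {a b : Bool} → (a ≡ true → b ≡ true) → (b ≡ true → a ≡ true) → a ≡ b
bool-≡ a⇒b b⇒a = Bool.⇔→≡ {z = true} (mk⇔ a⇒b b⇒a)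

-- Finite sums

∑-mono-≤ : ∀ {n} {f g : Fin n → ℕ} → (∀ i → f i ≤ g i) → ∑ f ≤ ∑ g
∑-mono-≤ {zero} h = z≤n
∑-mono-≤ {suc n} h = +-mono-≤ (h zero) (∑-mono-≤ (h ∘ suc))

∑-mono-< : ∀ {n} {f g : Fin n → ℕ} (a : Fin n) → (∀ i → f i ≤ g i) → f a < g a → ∑ f < ∑ g
∑-mono-< {suc n} zero h lt = +-mono-<-≤ lt (∑-mono-≤ (h ∘ suc))
∑-mono-< {suc n} (suc a) h lt = +-mono-≤-< (h zero) (∑-mono-< a (h ∘ suc) lt)

𝟙 : Bool → ℕ
𝟙 true = 1
𝟙 false = 0

𝟙≤1 : ∀ b → 𝟙 b ≤ 1
𝟙≤1 true = ≤-refl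
𝟙≤1 false = z≤n

𝟙-≥1 : ∀ {b} → b ≡ true → 1 ≤ 𝟙 b
𝟙-≥1 refl = ≤-refl

𝟙-∧ : ∀ a b → 𝟙 (a ∧ b) ≡ 𝟙 a * 𝟙 b
𝟙-∧ true b = sym (+-identityʳ (𝟙 b))
𝟙-∧ false b = refl

𝟙-∨ : ∀ a b → 𝟙 (a ∨ b) ≤ 𝟙 a + 𝟙 b
𝟙-∨ true b = s≤s z≤n
𝟙-∨ false b = ≤-refl

𝟙-*-mono-≤ : ∀ b {m n} → (b ≡ true → m ≤ n) → 𝟙 b * m ≤ 𝟙 b * n
𝟙-*-mono-≤ true h = *-monoʳ-≤ 1 (h refl)
𝟙-*-mono-≤ false h = z≤n

𝟙-∧-falseˡ : ∀ {a} b → a ≡ false → 𝟙 (a ∧ b) ≡ 0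
𝟙-∧-falseˡ b refl = refl

𝟙-∧-falseʳ : ∀ a {b} → b ≡ false → 𝟙 (a ∧ b) ≡ 0
𝟙-∧-falseʳ a refl = cong 𝟙 (Bool.∧-zeroʳ a)

𝟙-∧₃-false : ∀ {c} a b → (a ≡ true → b ≡ true → c ≡ true → ⊥) → 𝟙 (a ∧ b ∧ c) ≡ 0
𝟙-∧₃-false {c} a b ¬abc with bool-cases a | bool-cases b | bool-cases c
... | inj₂ a≡false | _ | _ = 𝟙-∧-falseˡ (b ∧ c) a≡false
... | inj₁ refl | inj₂ b≡false | _ = 𝟙-∧-falseˡ c b≡false
... | inj₁ refl | inj₁ refl | inj₂ refl = refl
... | inj₁ refl | inj₁ refl | inj₁ refl = ⊥-elim (¬abc refl refl refl)

𝟙-∧-true : ∀ {a b} → a ≡ true → b ≡ true → 𝟙 (a ∧ b) ≡ 1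
𝟙-∧-true refl refl = refl

δ : ∀ {n} → Fin n → Fin n → ℕ
δ a x = 𝟙 ⌊ x ≟ a ⌋

δ-diag : ∀ {n} (a : Fin n) → δ a a ≡ 1
δ-diag a = cong 𝟙 (⌊≟⌋-yes refl)

δ-off : ∀ {n} {a x : Fin n} → x ≢ a → δ a x ≡ 0
δ-off x≢a = cong 𝟙 (⌊≟⌋-no x≢a)

∑-δ-* : ∀ {n} (a : Fin n) (f : Fin n → ℕ) → ∑ (λ x → δ a x * f x) ≡ f a
∑-δ-* {suc n} zero f = begin
    1 * f zero + ∑ (λ x → δ zero (suc x) * f (suc x))
  ≡⟨ cong₂ _+_ (*-identityˡ (f zero)) (sum-cong-≗ (λ x → cong (_* f (suc x)) (δ-off {a = zero} {suc x} (λ ())))) ⟩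
    f zero + ∑ {n} (λ _ → 0)
  ≡⟨ cong (f zero +_) (sum-replicate-zero n) ⟩
    f zero + 0
  ≡⟨ +-identityʳ (f zero) ⟩
    f zero ∎
  where open ≡-Reasoning
∑-δ-* {suc n} (suc a) f = begin
    δ (suc a) zero * f zero + ∑ (λ x → δ (suc a) (suc x) * f (suc x))
  ≡⟨ cong₂ _+_ (cong (_* f zero) (δ-off {a = suc a} {zero} (λ ())))
               (sum-cong-≗ (λ x → cong (λ t → 𝟙 t * f (suc x)) (⌊suc≟suc⌋ x))) ⟩
    ∑ (λ x → δ a x * f (suc x))
  ≡⟨ ∑-δ-* a (f ∘ suc) ⟩
    f (suc a) ∎
  where
  open ≡-Reasoning
  ⌊suc≟suc⌋ : ∀ x → ⌊ suc x ≟ suc a ⌋ ≡ ⌊ x ≟ a ⌋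
  ⌊suc≟suc⌋ x = ⌊⌋-map′ (cong suc) Fin.suc-injective (x ≟ a)

∑-δ : ∀ {n} (a : Fin n) → ∑ (δ a) ≡ 1
∑-δ a = trans (sum-cong-≗ (λ x → sym (*-identityʳ (δ a x)))) (∑-δ-* a (λ _ → 1))

∑∑-δˡ : ∀ {n} (a : Fin n) (F : Fin n → Fin n → ℕ) →
  ∑ (λ x → ∑ (λ z → δ a x * F x z)) ≡ ∑ (F a)
∑∑-δˡ a F = trans (sum-cong-≗ (λ x → sym (*-distribˡ-sum (δ a x) (F x)))) (∑-δ-* a (λ x → ∑ (F x)))

∑∑-δʳ : ∀ {n} (a : Fin n) (K : Fin n → ℕ) → ∑ (λ x → ∑ (λ z → δ a z * K x)) ≡ ∑ K
∑∑-δʳ a K = sum-cong-≗ (λ x → ∑-δ-* a (λ _ → K x))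

∑∑-distrib-+ : ∀ {n} (F H : Fin n → Fin n → ℕ) →
  ∑ (λ x → ∑ (λ z → F x z + H x z)) ≡ ∑ (λ x → ∑ (F x)) + ∑ (λ x → ∑ (H x))
∑∑-distrib-+ F H = trans (sum-cong-≗ (λ x → ∑-distrib-+ (F x) (H x))) (∑-distrib-+ (λ x → ∑ (F x)) (λ x → ∑ (H x)))

∑∑-mono-≤ : ∀ {n} {F H : Fin n → Fin n → ℕ} → (∀ x z → F x z ≤ H x z) →
  ∑ (λ x → ∑ (F x)) ≤ ∑ (λ x → ∑ (H x))
∑∑-mono-≤ h = ∑-mono-≤ (λ x → ∑-mono-≤ (h x))

∑-weighted : ∀ {n} → (Fin n → Fin n → ℕ) → (Fin n → ℕ) → ℕ
∑-weighted c f = ∑ (λ x → ∑ (λ z → c x z * f x))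

∑-weighted-+ : ∀ {n} (c c′ : Fin n → Fin n → ℕ) (f : Fin n → ℕ) →
  ∑-weighted c f + ∑-weighted c′ f ≡ ∑-weighted (λ x z → c x z + c′ x z) f
∑-weighted-+ c c′ f = trans (sym (∑∑-distrib-+ (λ x z → c x z * f x) (λ x z → c′ x z * f x)))
  (sum-cong-≗ (λ x → sum-cong-≗ (λ z → sym (*-distribʳ-+ (f x) (c x z) (c′ x z)))))

∑-weighted-+₅ : ∀ {n} (c₁ c₂ c₃ c₄ c₅ : Fin n → Fin n → ℕ) (f : Fin n → ℕ) →
  ∑-weighted c₁ f + ∑-weighted c₂ f + ∑-weighted c₃ f + ∑-weighted c₄ f + ∑-weighted c₅ f
  ≡ ∑-weighted (λ x z → c₁ x z + c₂ x z + c₃ x z + c₄ x z + c₅ x z) f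
∑-weighted-+₅ c₁ c₂ c₃ c₄ c₅ f =
  trans (cong (λ t → t + ∑-weighted c₃ f + ∑-weighted c₄ f + ∑-weighted c₅ f) (∑-weighted-+ c₁ c₂ f))
  (trans (cong (λ t → t + ∑-weighted c₄ f + ∑-weighted c₅ f) (∑-weighted-+ (λ x z → c₁ x z + c₂ x z) c₃ f))
  (trans (cong (_+ ∑-weighted c₅ f) (∑-weighted-+ (λ x z → c₁ x z + c₂ x z + c₃ x z) c₄ f))
         (∑-weighted-+ (λ x z → c₁ x z + c₂ x z + c₃ x z + c₄ x z) c₅ f)))

∑-weighted-mono-≤ : ∀ {n} {c c′ : Fin n → Fin n → ℕ} (f : Fin n → ℕ) →
  (∀ x z → c x z ≤ c′ x z) → ∑-weighted c f ≤ ∑-weighted c′ f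
∑-weighted-mono-≤ f c≤c′ = ∑∑-mono-≤ (λ x z → *-monoˡ-≤ (f x) (c≤c′ x z))

∑-edges : ∀ {n} → (Fin n → Fin n → Bool) → (Fin n → ℕ) → ℕ
∑-edges E = ∑-weighted (λ x z → 𝟙 (E x z))

∑-edges-∨ : ∀ {n} (E F : Fin n → Fin n → Bool) (f : Fin n → ℕ) →
  ∑-edges (λ x z → E x z ∨ F x z) f ≤ ∑-edges E f + ∑-edges F f
∑-edges-∨ E F f = subst (∑-edges (λ x z → E x z ∨ F x z) f ≤_)
  (sym (∑-weighted-+ (λ x z → 𝟙 (E x z)) (λ x z → 𝟙 (F x z)) f))
  (∑-weighted-mono-≤ f (λ x z → 𝟙-∨ (E x z) (F x z)))

∑-edges-from : ∀ {n} (a : Fin n) (R : Fin n → Fin n → Bool) (f : Fin n → ℕ) →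
  ∑-edges (λ x z → ⌊ x ≟ a ⌋ ∧ R x z) f ≡ ∑ (λ z → 𝟙 (R a z)) * f a
∑-edges-from a R f = begin
    ∑-edges (λ x z → ⌊ x ≟ a ⌋ ∧ R x z) f
  ≡⟨ sum-cong-≗ (λ x → sum-cong-≗ (λ z → trans (cong (_* f x) (𝟙-∧ ⌊ x ≟ a ⌋ (R x z))) (*-assoc (δ a x) _ _))) ⟩
    ∑ (λ x → ∑ (λ z → δ a x * (𝟙 (R x z) * f x)))
  ≡⟨ ∑∑-δˡ a (λ x z → 𝟙 (R x z) * f x) ⟩
    ∑ (λ z → 𝟙 (R a z) * f a)
  ≡⟨ *-distribʳ-sum (f a) (λ z → 𝟙 (R a z)) ⟨
    ∑ (λ z → 𝟙 (R a z)) * f a ∎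
  where open ≡-Reasoning

∑-edges-to : ∀ {n} (a : Fin n) (L : Fin n → Bool) (R : Fin n → Fin n → Bool) (f : Fin n → ℕ) →
  ∑-edges (λ x z → L x ∧ ⌊ z ≟ a ⌋ ∧ R x z) f ≡ ∑ (λ x → 𝟙 (L x ∧ R x a) * f x)
∑-edges-to a L R f = trans (sum-cong-≗ (λ x → sum-cong-≗ (only-a x))) (∑∑-δʳ a (λ x → 𝟙 (L x ∧ R x a) * f x))
  where
  only-a : ∀ x z → 𝟙 (L x ∧ ⌊ z ≟ a ⌋ ∧ R x z) * f x ≡ δ a z * (𝟙 (L x ∧ R x a) * f x)
  only-a x z with z ≟ a
  ... | yes refl = sym (+-identityʳ _)
  ... | no _ = cong (λ b → 𝟙 b * f x) (Bool.∧-zeroʳ (L x))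

erase : ∀ {n} → Fin n → (Fin n → ℕ) → Fin n → ℕ
erase a f x = if ⌊ x ≟ a ⌋ then 0 else f x

erase-≢ : ∀ {n} {a x : Fin n} (f : Fin n → ℕ) → x ≢ a → erase a f x ≡ f x
erase-≢ {a = a} {x} f x≢a rewrite ⌊≟⌋-no x≢a = refl

∑-erase : ∀ {n} (a : Fin n) (f : Fin n → ℕ) → ∑ f ≡ f a + ∑ (erase a f)
∑-erase a f = begin
    ∑ f
  ≡⟨ sum-cong-≗ split ⟩
    ∑ (λ x → δ a x * f x + erase a f x)
  ≡⟨ ∑-distrib-+ (λ x → δ a x * f x) (erase a f) ⟩
    ∑ (λ x → δ a x * f x) + ∑ (erase a f)
  ≡⟨ cong (_+ ∑ (erase a f)) (∑-δ-* a f) ⟩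
    f a + ∑ (erase a f) ∎
  where
  open ≡-Reasoning
  split : ∀ x → f x ≡ δ a x * f x + erase a f x
  split x with x ≟ a
  ... | yes _ = sym (trans (+-identityʳ _) (*-identityˡ (f x)))
  ... | no _ = refl

∑-≤-except₂ : ∀ {n} {f g : Fin n → ℕ} (a b : Fin n) (e : ℕ) → a ≢ b →
  f a + f b + e ≤ g a + g b → (∀ x → x ≢ a → x ≢ b → f x ≤ g x) → ∑ f + e ≤ ∑ g
∑-≤-except₂ {f = f} {g} a b e a≢b ab-bound elsewhere = begin
    ∑ f + e
  ≡⟨ cong (_+ e) (split f) ⟩
    f a + (f b + ∑ (erase b (erase a f))) + e
  ≡⟨ regroup (f a) (f b) (∑ (erase b (erase a f))) e ⟩
    (f a + f b + e) + ∑ (erase b (erase a f))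
  ≤⟨ +-mono-≤ ab-bound (∑-mono-≤ rest) ⟩
    (g a + g b) + ∑ (erase b (erase a g))
  ≡⟨ +-assoc (g a) (g b) _ ⟩
    g a + (g b + ∑ (erase b (erase a g)))
  ≡⟨ split g ⟨
    ∑ g ∎
  where
  open ≤-Reasoning
  regroup : ∀ p q r s → p + (q + r) + s ≡ (p + q + s) + r
  regroup = solve-∀
  split : ∀ h → ∑ h ≡ h a + (h b + ∑ (erase b (erase a h)))
  split h = trans (∑-erase a h)
    (cong (h a +_) (trans (∑-erase b (erase a h)) (cong (_+ ∑ (erase b (erase a h))) (erase-≢ h (a≢b ∘ sym)))))
  rest : ∀ x → erase b (erase a f) x ≤ erase b (erase a g) x
  rest x with x ≟ b | x ≟ a
  ... | yes _ | _ = ≤-refl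
  ... | no _ | yes _ = ≤-refl
  ... | no x≢b | no x≢a = elsewhere x x≢a x≢b

∑-<-except₂ : ∀ {n} {f g : Fin n → ℕ} (a b c : Fin n) → a ≢ b → c ≢ a → c ≢ b →
  f a + f b ≤ g a + g b → (∀ x → x ≢ a → x ≢ b → f x ≤ g x) → f c < g c → ∑ f < ∑ g
∑-<-except₂ {f = f} {g} a b c a≢b c≢a c≢b ab-bound elsewhere fc<gc =
  subst (_≤ ∑ g) shifted (∑-≤-except₂ {f = λ x → f x + δ c x} a b 0 a≢b ab-bound′ elsewhere′)
  where
  shifted : ∑ (λ x → f x + δ c x) + 0 ≡ suc (∑ f)
  shifted = trans (+-identityʳ _)
    (trans (∑-distrib-+ f (δ c)) (trans (cong (∑ f +_) (∑-δ c)) (+-comm (∑ f) 1)))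
  ab-bound′ : f a + δ c a + (f b + δ c b) + 0 ≤ g a + g b
  ab-bound′ rewrite δ-off (c≢a ∘ sym) | δ-off (c≢b ∘ sym)
                  | +-identityʳ (f a) | +-identityʳ (f b) | +-identityʳ (f a + f b) = ab-bound
  elsewhere′ : ∀ x → x ≢ a → x ≢ b → f x + δ c x ≤ g x
  elsewhere′ x x≢a x≢b with x ≟ c
  ... | yes refl = subst (_≤ g x) (+-comm 1 (f x)) fc<gc
  ... | no _ = subst (_≤ g x) (sym (+-identityʳ (f x))) (elsewhere x x≢a x≢b)

≤-by-parts : ∀ {a b c d e t a′ b′ c′ d′ e′} → a ≡ a′ → b ≡ b′ → c ≡ c′ → d ≡ d′ → e ≡ e′ →
  a′ + b′ + c′ + d′ + e′ ≤ t → a + b + c + d + e ≤ t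
≤-by-parts refl refl refl refl refl bound = bound

-- Walks and distances

module Distance {n : ℕ} (B : Graph n) where

  -- A record, so that k, x and y can be inferred from a walk.
  record Walk (k : ℕ) (x y : Fin n) : Set where
    constructor mkWalk
    field isWalk : walkOf B k x y ≡ true
  open Walk

  walk₀⇒≡ : ∀ {x y} → Walk 0 x y → x ≡ y
  walk₀⇒≡ (mkWalk eq) = ⌊≟⌋-sound eq

  walk-refl : ∀ {x} → Walk 0 x x
  walk-refl = mkWalk (⌊≟⌋-yes refl)

  walk-∷ : ∀ {k x z y} → B x z ≡ true → Walk k z y → Walk (suc k) x y
  walk-∷ {k} {x} {z} {y} xz (mkWalk w) =
    mkWalk (any-allFin-intro (λ t → B x t ∧ walkOf B k t y) z (∧-intro xz w))

  walk-uncons : ∀ {k x y} → Walk (suc k) x y → Σ (Fin n) (λ z → B x z ≡ true × Walk k z y)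
  walk-uncons {k} {x} {y} (mkWalk w) with any-allFin-elim (λ t → B x t ∧ walkOf B k t y) w
  ... | z , xz∧w = z , ∧-elimˡ xz∧w , mkWalk (∧-elimʳ {B x z} xz∧w)

  walk-++ : ∀ a {b x z y} → Walk a x z → Walk b z y → Walk (a + b) x y
  walk-++ zero w₁ w₂ rewrite walk₀⇒≡ w₁ = w₂
  walk-++ (suc a) w₁ w₂ with walk-uncons w₁
  ... | _ , xt , w = walk-∷ xt (walk-++ a w w₂)

  walk-split : ∀ a {b x y} → Walk (a + b) x y → Σ (Fin n) (λ z → Walk a x z × Walk b z y)
  walk-split zero {x = x} w = x , walk-refl , w
  walk-split (suc a) w with walk-uncons w
  ... | _ , xt , w′ with walk-split a w′
  ...   | z , w₁ , w₂ = z , walk-∷ xt w₁ , w₂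

  search : ℕ → ℕ → Fin n → Fin n → ℕ
  search k fuel x y = searchDist B x y k fuel

  search-≤ : ∀ {x y} j k fuel → Walk j x y → k ≤ j → search k fuel x y ≤ j
  search-≤ j k zero w k≤j = k≤j
  search-≤ {x} {y} j k (suc fuel) w k≤j with walkOf B k x y in found
  ... | true = k≤j
  ... | false with k ≟ℕ j
  ...   | yes refl = ⊥-elim (true≢false (isWalk w) found)
  ...   | no k≢j = search-≤ j (suc k) fuel w (≤∧≢⇒< k≤j k≢j)

  search-found : ∀ {x y} k fuel → search k fuel x y < k + fuel → Walk (search k fuel x y) x y
  search-found k zero lt = ⊥-elim (<-irrefl (sym (+-identityʳ k)) lt)
  search-found {x} {y} k (suc fuel) lt with walkOf B k x y in found
  ... | true = mkWalk found
  ... | false = search-found (suc k) fuel (subst (search (suc k) fuel x y <_) (+-suc k fuel) lt)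

  search-minimal : ∀ {x y} k fuel i → k ≤ i → i < search k fuel x y → ¬ Walk i x y
  search-minimal k zero i k≤i i< w = <-irrefl refl (≤-<-trans k≤i i<)
  search-minimal {x} {y} k (suc fuel) i k≤i i< w with walkOf B k x y in found
  ... | true = <-irrefl refl (≤-<-trans k≤i i<)
  ... | false with k ≟ℕ i
  ...   | yes refl = true≢false (isWalk w) found
  ...   | no k≢i = search-minimal (suc k) fuel i (≤∧≢⇒< k≤i k≢i) i< w

  dist-≤-walk : ∀ {k x y} → Walk k x y → dist B x y ≤ k
  dist-≤-walk {k} w = search-≤ k 0 n w z≤n

  -- The search bound n in dist suffices: a shortest walk repeats no vertex (pigeonhole).
  walk-shorter-than-n : ∀ {k x y} → Walk k x y → Σ ℕ (λ j → j < n × Walk j x y)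
  walk-shorter-than-n {k} {x} {y} w = by-length (r <? n)
    where
    r : ℕ
    r = search 0 (suc k) x y
    shortest : Walk r x y
    shortest = search-found 0 (suc k) (s≤s (search-≤ k 0 (suc k) w z≤n))
    r-split : (i : Fin (suc r)) → r ≡ toℕ i + (r ∸ toℕ i)
    r-split i = sym (m+[n∸m]≡n (≤-pred (Fin.toℕ<n i)))
    halves : (i : Fin (suc r)) → Σ (Fin n) (λ z → Walk (toℕ i) x z × Walk (r ∸ toℕ i) z y)
    halves i = walk-split (toℕ i) (subst (λ t → Walk t x y) (r-split i) shortest)
    visit : Fin (suc r) → Fin n
    visit i = proj₁ (halves i)
    no-repeat : Σ (Fin (suc r)) (λ i → Σ (Fin (suc r)) (λ j → Data.Fin._<_ i j × visit i ≡ visit j)) → ⊥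
    no-repeat (i , j , i<j , same) =
      search-minimal 0 (suc k) (toℕ i + (r ∸ toℕ j)) z≤n shorter
        (walk-++ (toℕ i) (proj₁ (proj₂ (halves i)))
           (subst (λ t → Walk (r ∸ toℕ j) t y) (sym same) (proj₂ (proj₂ (halves j)))))
      where
      shorter : toℕ i + (r ∸ toℕ j) < r
      shorter = subst (toℕ i + (r ∸ toℕ j) <_) (sym (r-split j)) (+-monoˡ-< (r ∸ toℕ j) i<j)
    by-length : Dec (r < n) → Σ ℕ (λ j → j < n × Walk j x y)
    by-length (yes r<n) = r , r<n , shortest
    by-length (no r≮n) = ⊥-elim (no-repeat (Fin.pigeonhole (s≤s (≮⇒≥ r≮n)) visit))

  dist-walk : ∀ {k x y} → Walk k x y → Walk (dist B x y) x y
  dist-walk w with walk-shorter-than-n w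
  ... | j , j<n , wj = search-found 0 n (≤-<-trans (dist-≤-walk wj) j<n)

  dist-refl : ∀ x → dist B x x ≡ 0
  dist-refl x = n≤0⇒n≡0 (dist-≤-walk (walk-refl {x}))

  dist-≤1 : ∀ {x y} → B x y ≡ true → dist B x y ≤ 1
  dist-≤1 xy = dist-≤-walk (walk-∷ xy walk-refl)

  dist-≤2 : ∀ {x z y} → B x z ≡ true → B z y ≡ true → dist B x y ≤ 2
  dist-≤2 xz zy = dist-≤-walk (walk-∷ xz (walk-∷ zy walk-refl))

  dist-≥1 : ∀ {k x y} → Walk k x y → x ≢ y → 1 ≤ dist B x y
  dist-≥1 {x = x} {y} w x≢y = n≢0⇒n>0 (λ d≡0 → x≢y (walk₀⇒≡ (subst (λ t → Walk t x y) d≡0 (dist-walk w))))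

  dist-≥2 : ∀ {k x y} → Walk k x y → x ≢ y → B x y ≢ true → 2 ≤ dist B x y
  dist-≥2 {x = x} {y} w x≢y ¬xy with 2 ≤? dist B x y
  ... | yes 2≤d = 2≤d
  ... | no 2≰d with m≤n⇒m<n∨m≡n (≤-pred (≰⇒> 2≰d))
  ...   | inj₁ d<1 = ⊥-elim (<-irrefl refl (≤-<-trans (dist-≥1 w x≢y) d<1))
  ...   | inj₂ d≡1 with walk-uncons (subst (λ t → Walk t x y) d≡1 (dist-walk w))
  ...     | z , xz , w₀ = ⊥-elim (¬xy (subst (λ t → B x t ≡ true) (walk₀⇒≡ w₀) xz))

-- A map sending every edge of B to an edge of B′ or contracting it does not increase distances;
-- if a label s is constant along the edges that are not contracted, each change of label along a
-- walk is paid for by a contracted edge.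
module Contraction {n : ℕ} (B B′ : Graph n) (π : Fin n → Fin n) (s : Fin n → Bool)
  (edge-image : ∀ x z → B x z ≡ true → (B′ (π x) (π z) ≡ true × s x ≡ s z) ⊎ (π x ≡ π z)) where

  private
    module D = Distance B
    module D′ = Distance B′

  contract-walk : ∀ k {x y} → D.Walk k x y →
    Σ ℕ (λ k′ → D′.Walk k′ (π x) (π y) × k′ + 𝟙 (s x xor s y) ≤ k)
  contract-walk zero {x} w with D.walk₀⇒≡ w
  ... | refl = 0 , D′.walk-refl , ≤-reflexive (cong 𝟙 (Bool.xor-same (s x)))
  contract-walk (suc k) {x} {y} w with D.walk-uncons w
  ... | z , xz , w₀ with contract-walk k w₀ | edge-image x z xz
  ...   | k′ , w′ , bound | inj₁ (πxz , sx≡sz) =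
          suc k′ , D′.walk-∷ πxz w′ , s≤s (subst (λ t → k′ + 𝟙 (t xor s y) ≤ k) (sym sx≡sz) bound)
  ...   | k′ , w′ , bound | inj₂ πx≡πz =
          k′ , subst (λ t → D′.Walk k′ t (π y)) (sym πx≡πz) w′ ,
          ≤-trans (+-monoʳ-≤ k′ (𝟙≤1 (s x xor s y)))
            (≤-trans (≤-reflexive (+-comm k′ 1)) (s≤s (≤-trans (m≤m+n k′ _) bound)))

  dist-contract-labelled : ∀ {k x y} → D.Walk k x y →
    dist B′ (π x) (π y) + 𝟙 (s x xor s y) ≤ dist B x y
  dist-contract-labelled {x = x} {y} w with contract-walk (dist B x y) (D.dist-walk w)
  ... | k′ , w′ , bound = ≤-trans (+-monoˡ-≤ _ (D′.dist-≤-walk w′)) bound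

dist-contract : ∀ {n} (B B′ : Graph n) (π : Fin n → Fin n) →
  (∀ x z → B x z ≡ true → B′ (π x) (π z) ≡ true ⊎ π x ≡ π z) →
  ∀ {k x y} → Distance.Walk B k x y → dist B′ (π x) (π y) ≤ dist B x y
dist-contract B B′ π edge-image w =
  ≤-trans (m≤m+n _ _) (Contraction.dist-contract-labelled B B′ π (λ _ → false) unlabelled w)
  where
  unlabelled : ∀ x z → B x z ≡ true → (B′ (π x) (π z) ≡ true × false ≡ false) ⊎ (π x ≡ π z)
  unlabelled x z xz with edge-image x z xz
  ... | inj₁ e = inj₁ (e , refl)
  ... | inj₂ e = inj₂ e

sumᴸ-tabulate : ∀ {n} (f : Fin n → ℕ) → sumᴸ (List.tabulate f) ≡ ∑ f
sumᴸ-tabulate {zero} f = refl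
sumᴸ-tabulate {suc n} f = cong (f zero +_) (sumᴸ-tabulate (f ∘ suc))

sumᴸ-map-allFin : ∀ {n} (f : Fin n → ℕ) → sumᴸ (map f (allFin n)) ≡ ∑ f
sumᴸ-map-allFin f = trans (cong sumᴸ (map-tabulate (λ i → i) f)) (sumᴸ-tabulate f)

∣tabulate∣ : ∀ {n} (p : Fin n → Bool) → ∣ tabulate p ∣ ≡ ∑ (𝟙 ∘ p)
∣tabulate∣ {zero} p = refl
∣tabulate∣ {suc n} p with p zero
... | true = cong suc (∣tabulate∣ (p ∘ suc))
... | false = ∣tabulate∣ (p ∘ suc)

∣∣≡∑ : ∀ {n} (S : Subset n) → ∣ S ∣ ≡ ∑ (𝟙 ∘ lookup S)
∣∣≡∑ S = trans (cong ∣_∣ (sym (tabulate∘lookup S))) (∣tabulate∣ (lookup S))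

degreeDistance≡∑-edges : ∀ {n} (B : Graph n) → degreeDistance B ≡ ∑-edges B (λ x → ∑ (dist B x))
degreeDistance≡∑-edges {n} B = begin
    degreeDistance B
  ≡⟨ sumᴸ-map-allFin (λ x → deg B x * distSum B x) ⟩
    ∑ (λ x → deg B x * distSum B x)
  ≡⟨ sum-cong-≗ (λ x → cong₂ _*_ (∣tabulate∣ (B x)) (sumᴸ-map-allFin (dist B x))) ⟩
    ∑ (λ x → ∑ (λ z → 𝟙 (B x z)) * ∑ (dist B x))
  ≡⟨ sum-cong-≗ (λ x → *-distribʳ-sum (∑ (dist B x)) (λ z → 𝟙 (B x z))) ⟩
    ∑-edges B (λ x → ∑ (dist B x)) ∎
  where open ≡-Reasoning

∃-other-element : ∀ {n} (S : Subset n) (a : Fin n) → 2 ≤ ∣ S ∣ →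
  Σ (Fin n) (λ b → lookup S b ≡ true × b ≢ a)
∃-other-element S a 2≤∣S∣ with Fin.any? (λ b → (lookup S b Bool.≟ true) ×-dec ¬? (b ≟ a))
... | yes (b , b∈S , b≢a) = b , b∈S , b≢a
... | no none = ⊥-elim (<-irrefl refl
        (≤-trans 2≤∣S∣ (subst (_≤ 1) (sym (∣∣≡∑ S)) (≤-trans (∑-mono-≤ below-δ) (≤-reflexive (∑-δ a))))))
  where
  below-δ : ∀ x → 𝟙 (lookup S x) ≤ δ a x
  below-δ x with x ≟ a | bool-cases (lookup S x)
  ... | yes refl | _ = 𝟙≤1 (lookup S x)
  ... | no x≢a | inj₁ x∈S = ⊥-elim (none (x , x∈S , x≢a))
  ... | no _ | inj₂ x∉S rewrite x∉S = z≤n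

singleton-unique : ∀ {n} (S : Subset n) (a : Fin n) → lookup S a ≡ true → ∣ S ∣ ≡ 1 →
  ∀ y → lookup S y ≡ true → y ≡ a
singleton-unique S a a∈S ∣S∣≡1 y y∈S with y ≟ a
... | yes y≡a = y≡a
... | no y≢a = ⊥-elim (<-irrefl refl
        (≤-trans (≤-reflexive (sym two)) (≤-trans (∑-mono-≤ below-S) (≤-reflexive (trans (sym (∣∣≡∑ S)) ∣S∣≡1)))))
  where
  two : ∑ (λ x → δ a x + δ y x) ≡ 2
  two = trans (∑-distrib-+ (δ a) (δ y)) (cong₂ _+_ (∑-δ a) (∑-δ y))
  below-S : ∀ x → δ a x + δ y x ≤ 𝟙 (lookup S x)
  below-S x with x ≟ a | x ≟ y
  ... | yes refl | yes refl = ⊥-elim (y≢a refl)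
  ... | yes refl | no _ rewrite a∈S = ≤-refl
  ... | no _ | yes refl rewrite y∈S = ≤-refl
  ... | no _ | no _ = z≤n

-- The configuration G = M ∪ T ∪ N and the graph G*

module Configuration {n : ℕ} (A : Graph n) (g : Gluing A) where
  open Gluing g public

  G* : Graph n
  G* = gStar g

  inM inT inN : Fin n → Bool
  inM x = lookup M x
  inT x = lookup T x
  inN x = lookup N x

  isU isV inN° inP : Fin n → Bool
  isU z = ⌊ z ≟ u ⌋
  isV z = ⌊ z ≟ v ⌋
  inN° z = inN z ∧ not (isV z)
  inP z = inT z ∧ not (isU z)

  eM eN° euN° eN°u euP ePu : Fin n → Fin n → Bool
  eM x y = inM x ∧ inM y ∧ A x y
  eN° x y = inN° x ∧ inN° y ∧ A x y
  euN° x y = isU x ∧ inN° y ∧ A v y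
  eN°u x y = inN° x ∧ isU y ∧ A x v
  euP x y = isU x ∧ inP y
  ePu x y = inP x ∧ isU y

  ∈⇒true : ∀ {S : Subset n} {x} → x ∈ S → lookup S x ≡ true
  ∈⇒true = []=⇒lookup

  true⇒∈ : ∀ {S : Subset n} {x} → lookup S x ≡ true → x ∈ S
  true⇒∈ {S} {x} = lookup⇒[]= x S

  symm : ∀ x y → A x y ≡ A y x
  symm = Simple.symm simple

  adj⇒≢ : ∀ {x y} → A x y ≡ true → x ≢ y
  adj⇒≢ {x} xy refl = true≢false xy (Simple.irrefl simple x)

  u≢v : u ≢ v
  u≢v u≡v = M∩N u u∈M (subst (_∈ N) (sym u≡v) v∈N)

  module DG = Distance A
  module DG* = Distance G*

  Reachable : Fin n → Fin n → Set
  Reachable x y = Σ ℕ (λ k → DG.Walk k x y)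

  walkIn⇒reachable : ∀ {S x y} → WalkIn A S x y → Reachable x y
  walkIn⇒reachable (here _) = 0 , DG.walk-refl
  walkIn⇒reachable (step _ xz w) with walkIn⇒reachable w
  ... | k , w′ = suc k , DG.walk-∷ xz w′

  reachable-trans : ∀ {x z y} → Reachable x z → Reachable z y → Reachable x y
  reachable-trans (k , w₁) (_ , w₂) = _ , DG.walk-++ k w₁ w₂

  T-reachable : ∀ {x y} → x ∈ T → y ∈ T → Reachable x y
  T-reachable x∈T y∈T = walkIn⇒reachable (proj₂ (proj₁ T-tree) _ _ x∈T y∈T)

  reachable-to-u : ∀ x → Reachable x u
  reachable-to-u x with cover x
  ... | inj₁ x∈M = walkIn⇒reachable (proj₂ M-conn x u x∈M u∈M)
  ... | inj₂ (inj₁ x∈T) = T-reachable x∈T u∈T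
  ... | inj₂ (inj₂ x∈N) = reachable-trans (walkIn⇒reachable (proj₂ N-conn x v x∈N v∈N)) (T-reachable v∈T u∈T)

  reachable-from-u : ∀ x → Reachable u x
  reachable-from-u x with cover x
  ... | inj₁ x∈M = walkIn⇒reachable (proj₂ M-conn u x u∈M x∈M)
  ... | inj₂ (inj₁ x∈T) = T-reachable u∈T x∈T
  ... | inj₂ (inj₂ x∈N) = reachable-trans (T-reachable u∈T v∈T) (walkIn⇒reachable (proj₂ N-conn v x v∈N x∈N))

  reachable : ∀ x y → Reachable x y
  reachable x y = reachable-trans (reachable-to-u x) (reachable-from-u y)

  connected : ∀ x y → DG.Walk (proj₁ (reachable x y)) x y
  connected x y = proj₂ (reachable x y)

  d d* : Fin n → Fin n → ℕ
  d = dist A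
  d* = dist G*

  D D* : Fin n → ℕ
  D x = ∑ (d x)
  D* x = ∑ (d* x)

  d-≥1 : ∀ {x y} → x ≢ y → 1 ≤ d x y
  d-≥1 {x} {y} = DG.dist-≥1 (connected x y)

  d-≥2 : ∀ {x y} → x ≢ y → A x y ≢ true → 2 ≤ d x y
  d-≥2 {x} {y} = DG.dist-≥2 (connected x y)

  d-refl : ∀ x → d x x ≡ 0
  d-refl = DG.dist-refl

  d≤1⇒adj : ∀ {x y} → x ≢ y → d x y ≤ 1 → A x y ≡ true
  d≤1⇒adj {x} {y} x≢y d≤1 with bool-cases (A x y)
  ... | inj₁ xy = xy
  ... | inj₂ ¬xy = ⊥-elim (<-irrefl refl (≤-<-trans (d-≥2 x≢y (λ xy → true≢false xy ¬xy)) (s≤s d≤1)))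

  M⇒¬N : ∀ {x} → inM x ≡ true → inN x ≡ false
  M⇒¬N {x} x∈M = Bool.¬-not (λ x∈N → M∩N x (true⇒∈ x∈M) (true⇒∈ x∈N))

  N⇒¬M : ∀ {x} → inN x ≡ true → inM x ≡ false
  N⇒¬M {x} x∈N = Bool.¬-not (λ x∈M → M∩N x (true⇒∈ x∈M) (true⇒∈ x∈N))

  M∩T⇒u : ∀ {x} → inM x ≡ true → inT x ≡ true → x ≡ u
  M∩T⇒u x∈M x∈T = M∩T _ (true⇒∈ x∈M) (true⇒∈ x∈T)

  M∩T-edge-⊥ : ∀ {x z} → inM x ≡ true → inM z ≡ true → inT x ≡ true → inT z ≡ true → A x z ≡ true → ⊥
  M∩T-edge-⊥ x∈M z∈M x∈T z∈T xz = adj⇒≢ xz (trans (M∩T⇒u x∈M x∈T) (sym (M∩T⇒u z∈M z∈T)))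

  T∩N⇒v : ∀ {x} → inT x ≡ true → inN x ≡ true → x ≡ v
  T∩N⇒v x∈T x∈N = T∩N _ (true⇒∈ x∈T) (true⇒∈ x∈N)

  u-inM : inM u ≡ true
  u-inM = ∈⇒true u∈M

  u-inT : inT u ≡ true
  u-inT = ∈⇒true u∈T

  v-inT : inT v ≡ true
  v-inT = ∈⇒true v∈T

  v-inN : inN v ≡ true
  v-inN = ∈⇒true v∈N

  isU-u : isU u ≡ true
  isU-u = ⌊≟⌋-yes refl

  inP-intro : ∀ {p} → inT p ≡ true → p ≢ u → inP p ≡ true
  inP-intro p∈T p≢u rewrite p∈T | ⌊≟⌋-no p≢u = refl

  inP⇒inT : ∀ {p} → inP p ≡ true → inT p ≡ true
  inP⇒inT = ∧-elimˡ

  inP⇒≢u : ∀ {p} → inP p ≡ true → p ≢ u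
  inP⇒≢u {p} p∈P refl rewrite isU-u = true≢false (∧-elimʳ {inT p} p∈P) refl

  inN°-intro : ∀ {y} → inN y ≡ true → y ≢ v → inN° y ≡ true
  inN°-intro y∈N y≢v rewrite y∈N | ⌊≟⌋-no y≢v = refl

  inN°⇒inN : ∀ {y} → inN° y ≡ true → inN y ≡ true
  inN°⇒inN = ∧-elimˡ

  inN°⇒≢v : ∀ {y} → inN° y ≡ true → y ≢ v
  inN°⇒≢v {y} y∈N° refl rewrite ⌊≟⌋-yes (refl {x = v}) = true≢false (∧-elimʳ {inN v} y∈N°) refl

  inN°⇒¬T : ∀ {y} → inN° y ≡ true → inT y ≡ false
  inN°⇒¬T y∈N° = Bool.¬-not (λ y∈T → inN°⇒≢v y∈N° (T∩N⇒v y∈T (inN°⇒inN y∈N°)))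

  v-inP : inP v ≡ true
  v-inP = inP-intro v-inT (u≢v ∘ sym)

  G*-M : ∀ {x y} → inM x ≡ true → inM y ≡ true → A x y ≡ true → G* x y ≡ true
  G*-M {x} {y} x∈M y∈M xy =
    ∨-introˡ (eN° x y ∨ euN° x y ∨ eN°u x y ∨ euP x y ∨ ePu x y) (∧-intro x∈M (∧-intro y∈M xy))

  G*-N° : ∀ {x y} → inN° x ≡ true → inN° y ≡ true → A x y ≡ true → G* x y ≡ true
  G*-N° {x} {y} x∈N° y∈N° xy = ∨-introʳ (eM x y)
    (∨-introˡ (euN° x y ∨ eN°u x y ∨ euP x y ∨ ePu x y) (∧-intro x∈N° (∧-intro y∈N° xy)))

  G*-uN° : ∀ {y} → inN° y ≡ true → A v y ≡ true → G* u y ≡ true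
  G*-uN° {y} y∈N° vy = ∨-introʳ (eM u y) (∨-introʳ (eN° u y)
    (∨-introˡ (eN°u u y ∨ euP u y ∨ ePu u y) (∧-intro isU-u (∧-intro y∈N° vy))))

  G*-N°u : ∀ {x} → inN° x ≡ true → A x v ≡ true → G* x u ≡ true
  G*-N°u {x} x∈N° xv = ∨-introʳ (eM x u) (∨-introʳ (eN° x u) (∨-introʳ (euN° x u)
    (∨-introˡ (euP x u ∨ ePu x u) (∧-intro x∈N° (∧-intro isU-u xv)))))

  G*-uP : ∀ {p} → inP p ≡ true → G* u p ≡ true
  G*-uP {p} p∈P = ∨-introʳ (eM u p) (∨-introʳ (eN° u p) (∨-introʳ (euN° u p) (∨-introʳ (eN°u u p)
    (∨-introˡ (ePu u p) (∧-intro isU-u p∈P)))))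

  G*-Pu : ∀ {p} → inP p ≡ true → G* p u ≡ true
  G*-Pu {p} p∈P = ∨-introʳ (eM p u) (∨-introʳ (eN° p u) (∨-introʳ (euN° p u) (∨-introʳ (eN°u p u)
    (∨-introʳ (euP p u) (∧-intro p∈P isU-u)))))

  d*-refl : ∀ x → d* x x ≡ 0
  d*-refl = DG*.dist-refl

  d*-≤1 : ∀ {x y} → G* x y ≡ true → d* x y ≤ 1
  d*-≤1 = DG*.dist-≤1

  d*-uP-≤1 : ∀ {p} → inP p ≡ true → d* u p ≤ 1
  d*-uP-≤1 p∈P = d*-≤1 (G*-uP p∈P)

  d*-Pu-≤1 : ∀ {p} → inP p ≡ true → d* p u ≤ 1
  d*-Pu-≤1 p∈P = d*-≤1 (G*-Pu p∈P)

  d*-PP-≤2 : ∀ {p w} → inP p ≡ true → inP w ≡ true → d* p w ≤ 2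
  d*-PP-≤2 p∈P w∈P = DG*.dist-≤2 (G*-Pu p∈P) (G*-uP w∈P)

  data EdgeOf (x y : Fin n) : Set where
    within-M : inM x ≡ true → inM y ≡ true → EdgeOf x y
    within-T : inT x ≡ true → inT y ≡ true → EdgeOf x y
    within-N : inN x ≡ true → inN y ≡ true → EdgeOf x y

  edge-cases : ∀ {x y} → A x y ≡ true → EdgeOf x y
  edge-cases {x} {y} xy with edges x y xy
  ... | inj₁ (x∈ , y∈) = within-M (∈⇒true x∈) (∈⇒true y∈)
  ... | inj₂ (inj₁ (x∈ , y∈)) = within-T (∈⇒true x∈) (∈⇒true y∈)
  ... | inj₂ (inj₂ (x∈ , y∈)) = within-N (∈⇒true x∈) (∈⇒true y∈)

  N-cases : ∀ {x} → inN x ≡ true → (x ≡ v) ⊎ (inN° x ≡ true)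
  N-cases {x} x∈N = by-cases (x ≟ v)
    where
    by-cases : Dec (x ≡ v) → (x ≡ v) ⊎ (inN° x ≡ true)
    by-cases (yes x≡v) = inj₁ x≡v
    by-cases (no x≢v) = inj₂ (inN°-intro x∈N x≢v)

  N-edge-image : (π : Fin n → Fin n) → π v ≡ u → (∀ y → inN° y ≡ true → π y ≡ y) →
    ∀ {x y} → inN x ≡ true → inN y ≡ true → A x y ≡ true → G* (π x) (π y) ≡ true
  N-edge-image π πv πN° {x} {y} x∈N y∈N xy with N-cases x∈N | N-cases y∈N
  ... | inj₁ refl | inj₁ refl = ⊥-elim (adj⇒≢ xy refl)
  ... | inj₁ refl | inj₂ y∈N° rewrite πv | πN° y y∈N° = G*-uN° y∈N° xy
  ... | inj₂ x∈N° | inj₁ refl rewrite πv | πN° x x∈N° = G*-N°u x∈N° xy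
  ... | inj₂ x∈N° | inj₂ y∈N° rewrite πN° x x∈N° | πN° y y∈N° = G*-N° x∈N° y∈N° xy

  data VertexClass (w : Fin n) : Set where
    in-M : inM w ≡ true → VertexClass w
    in-N° : inN° w ≡ true → VertexClass w
    in-P : inT w ≡ true → w ≢ u → VertexClass w

  vertex-class : ∀ w → VertexClass w
  vertex-class w with cover w | w ≟ u
  ... | inj₁ w∈M | _ = in-M (∈⇒true w∈M)
  ... | inj₂ (inj₁ _) | yes refl = in-M u-inM
  ... | inj₂ (inj₁ w∈T) | no w≢u = in-P (∈⇒true w∈T) w≢u
  ... | inj₂ (inj₂ w∈N) | _ with N-cases (∈⇒true w∈N)
  ...   | inj₁ refl = in-P v-inT (u≢v ∘ sym)
  ...   | inj₂ w∈N° = in-N° w∈N°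

  P⇒¬M : ∀ {w} → inT w ≡ true → w ≢ u → inM w ≡ false
  P⇒¬M w∈T w≢u = Bool.¬-not (λ w∈M → w≢u (M∩T⇒u w∈M w∈T))

  M⇒¬N° : ∀ {x} → inM x ≡ true → inN° x ≡ false
  M⇒¬N° x∈M rewrite M⇒¬N x∈M = refl

  T⇒¬N° : ∀ {x} → inT x ≡ true → inN° x ≡ false
  T⇒¬N° x∈T = Bool.¬-not (λ x∈N° → true≢false x∈T (inN°⇒¬T x∈N°))

  inN°-v : inN° v ≡ false
  inN°-v rewrite ⌊≟⌋-yes (refl {x = v}) | v-inN = refl

  M⇒≢v : ∀ {x} → inM x ≡ true → x ≢ v
  M⇒≢v x∈M refl = true≢false x∈M (N⇒¬M v-inN)

  no-triangle : ∀ {x y z} → inT x ≡ true → inT y ≡ true → inT z ≡ true →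
    x ≢ y → x ≢ z → y ≢ z → A x y ≡ true → A y z ≡ true → A z x ≡ true → ⊥
  no-triangle {x} {y} {z} x∈T y∈T z∈T x≢y x≢z y≢z xy yz zx =
    proj₂ T-tree x (y ∷ z ∷ [])
      ( s≤s (s≤s (s≤s z≤n))
      , (x≢y ∷ x≢z ∷ []) ∷ (y≢z ∷ []) ∷ [] ∷ []
      , true⇒∈ x∈T ∷ true⇒∈ y∈T ∷ true⇒∈ z∈T ∷ []
      , xy , yz , zx , tt)

  no-square : ∀ {x y z w} → inT x ≡ true → inT y ≡ true → inT z ≡ true → inT w ≡ true →
    x ≢ y → x ≢ z → x ≢ w → y ≢ z → y ≢ w → z ≢ w →
    A x y ≡ true → A y z ≡ true → A z w ≡ true → A w x ≡ true → ⊥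
  no-square {x} {y} {z} {w} x∈T y∈T z∈T w∈T x≢y x≢z x≢w y≢z y≢w z≢w xy yz zw wx =
    proj₂ T-tree x (y ∷ z ∷ w ∷ [])
      ( s≤s (s≤s (s≤s z≤n))
      , (x≢y ∷ x≢z ∷ x≢w ∷ []) ∷ (y≢z ∷ y≢w ∷ []) ∷ (z≢w ∷ []) ∷ [] ∷ []
      , true⇒∈ x∈T ∷ true⇒∈ y∈T ∷ true⇒∈ z∈T ∷ true⇒∈ w∈T ∷ []
      , xy , yz , zw , wx , tt)

  T-edge-dist-≥3 : ∀ {p q w} → inT p ≡ true → inT q ≡ true → inT w ≡ true →
    p ≢ q → p ≢ w → q ≢ w → A p q ≡ true → 3 ≤ d p w + d q w
  T-edge-dist-≥3 {p} {q} {w} p∈T q∈T w∈T p≢q p≢w q≢w pq with bool-cases (A p w) | bool-cases (A q w)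
  ... | inj₂ ¬pw | _ = +-mono-≤ (d-≥2 p≢w (λ pw → true≢false pw ¬pw)) (d-≥1 q≢w)
  ... | inj₁ _ | inj₂ ¬qw = +-mono-≤ {1} (d-≥1 p≢w) (d-≥2 q≢w (λ qw → true≢false qw ¬qw))
  ... | inj₁ pw | inj₁ qw = ⊥-elim (no-triangle p∈T q∈T w∈T p≢q p≢w q≢w pq qw (trans (symm w p) pw))

  -- Each map below sends every edge of G to an edge of G* or contracts it; every comparison of a
  -- distance in G with one in G* is read off one of them.

  edge-or-equal-on-u-p : ∀ {p} → inP p ≡ true → ∀ {a b} → (a ≡ u ⊎ a ≡ p) → (b ≡ u ⊎ b ≡ p) →
    G* a b ≡ true ⊎ a ≡ b
  edge-or-equal-on-u-p p∈P (inj₁ refl) (inj₁ refl) = inj₂ refl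
  edge-or-equal-on-u-p p∈P (inj₁ refl) (inj₂ refl) = inj₁ (G*-uP p∈P)
  edge-or-equal-on-u-p p∈P (inj₂ refl) (inj₁ refl) = inj₁ (G*-Pu p∈P)
  edge-or-equal-on-u-p p∈P (inj₂ refl) (inj₂ refl) = inj₂ refl

  contractT : Fin n → Fin n
  contractT x = if inT x then u else x

  contractT-M : ∀ {x} → inM x ≡ true → contractT x ≡ x
  contractT-M {x} x∈M with inT x in x∈T
  ... | true = sym (M∩T⇒u x∈M x∈T)
  ... | false = refl

  contractT-T : ∀ {x} → inT x ≡ true → contractT x ≡ u
  contractT-T x∈T rewrite x∈T = refl

  contractT-N° : ∀ {x} → inN° x ≡ true → contractT x ≡ x
  contractT-N° x∈N° rewrite inN°⇒¬T x∈N° = refl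

  contractT-dist-M : ∀ x y → d* (contractT x) (contractT y) + 𝟙 (inM x xor inM y) ≤ d x y
  contractT-dist-M x y = Contraction.dist-contract-labelled A G* contractT inM edge-image (connected x y)
    where
    inM-v : ∀ {z} → inN z ≡ true → inM z ≡ inM v
    inM-v z∈N = trans (N⇒¬M z∈N) (sym (N⇒¬M v-inN))
    edge-image : ∀ x z → A x z ≡ true →
      (G* (contractT x) (contractT z) ≡ true × inM x ≡ inM z) ⊎ (contractT x ≡ contractT z)
    edge-image x z xz with edge-cases xz
    ... | within-M x∈M z∈M rewrite contractT-M x∈M | contractT-M z∈M =
      inj₁ (G*-M x∈M z∈M xz , trans x∈M (sym z∈M))
    ... | within-T x∈T z∈T = inj₂ (trans (contractT-T x∈T) (sym (contractT-T z∈T)))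
    ... | within-N x∈N z∈N =
      inj₁ (N-edge-image contractT (contractT-T v-inT) (λ _ → contractT-N°) x∈N z∈N xz
           , trans (inM-v x∈N) (sym (inM-v z∈N)))

  contractT-dist : ∀ x y → d* (contractT x) (contractT y) ≤ d x y
  contractT-dist x y = ≤-trans (m≤m+n _ _) (contractT-dist-M x y)

  keepM : Fin n → Fin n → Fin n
  keepM p x = if inM x then x else p

  keepM-M : ∀ {p x} → inM x ≡ true → keepM p x ≡ x
  keepM-M x∈M rewrite x∈M = refl

  keepM-¬M : ∀ {p x} → inM x ≡ false → keepM p x ≡ p
  keepM-¬M x∉M rewrite x∉M = refl

  keepM-dist : ∀ {p} → inP p ≡ true → ∀ x y → d* (keepM p x) (keepM p y) ≤ d x y
  keepM-dist {p} p∈P x y = dist-contract A G* (keepM p) edge-image (connected x y)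
    where
    keepM-T : ∀ {x} → inT x ≡ true → keepM p x ≡ u ⊎ keepM p x ≡ p
    keepM-T {x} x∈T with inM x in x∈M
    ... | true = inj₁ (M∩T⇒u x∈M x∈T)
    ... | false = inj₂ refl
    edge-image : ∀ x z → A x z ≡ true → G* (keepM p x) (keepM p z) ≡ true ⊎ keepM p x ≡ keepM p z
    edge-image x z xz with edge-cases xz
    ... | within-M x∈M z∈M rewrite keepM-M {p} x∈M | keepM-M {p} z∈M = inj₁ (G*-M x∈M z∈M xz)
    ... | within-T x∈T z∈T = edge-or-equal-on-u-p p∈P (keepM-T x∈T) (keepM-T z∈T)
    ... | within-N x∈N z∈N rewrite keepM-¬M {p} (N⇒¬M x∈N) | keepM-¬M {p} (N⇒¬M z∈N) = inj₂ refl

  inT° : Fin n → Bool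
  inT° x = inT x ∧ not (isU x) ∧ not (isV x)

  keepN° : Fin n → Fin n → Fin n
  keepN° p x = if inN° x then x else (if inT° x then p else u)

  keepN°-N° : ∀ {p x} → inN° x ≡ true → keepN° p x ≡ x
  keepN°-N° x∈N° rewrite x∈N° = refl

  keepN°-T° : ∀ {p x} → inT x ≡ true → x ≢ u → x ≢ v → keepN° p x ≡ p
  keepN°-T° x∈T x≢u x≢v rewrite T⇒¬N° x∈T | x∈T | ⌊≟⌋-no x≢u | ⌊≟⌋-no x≢v = refl

  keepN°-v : ∀ {p} → keepN° p v ≡ u
  keepN°-v rewrite inN°-v | v-inT | ⌊≟⌋-no (u≢v ∘ sym) | ⌊≟⌋-yes (refl {x = v}) = refl

  keepN°-dist : ∀ {p} → inP p ≡ true → ∀ x y → d* (keepN° p x) (keepN° p y) ≤ d x y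
  keepN°-dist {p} p∈P x y = dist-contract A G* (keepN° p) edge-image (connected x y)
    where
    keepN°-¬N° : ∀ {x} → inN° x ≡ false → keepN° p x ≡ u ⊎ keepN° p x ≡ p
    keepN°-¬N° {x} x∉N° rewrite x∉N° with inT° x
    ... | true = inj₂ refl
    ... | false = inj₁ refl
    edge-image : ∀ x z → A x z ≡ true → G* (keepN° p x) (keepN° p z) ≡ true ⊎ keepN° p x ≡ keepN° p z
    edge-image x z xz with edge-cases xz
    ... | within-M x∈M z∈M = edge-or-equal-on-u-p p∈P (keepN°-¬N° (M⇒¬N° x∈M)) (keepN°-¬N° (M⇒¬N° z∈M))
    ... | within-T x∈T z∈T = edge-or-equal-on-u-p p∈P (keepN°-¬N° (T⇒¬N° x∈T)) (keepN°-¬N° (T⇒¬N° z∈T))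
    ... | within-N x∈N z∈N = inj₁ (N-edge-image (keepN° p) keepN°-v (λ _ → keepN°-N°) x∈N z∈N xz)

  keepN°ᵥ : Fin n → Fin n
  keepN°ᵥ x = if inN° x then x else (if isV x then u else v)

  keepN°ᵥ-N° : ∀ {x} → inN° x ≡ true → keepN°ᵥ x ≡ x
  keepN°ᵥ-N° x∈N° rewrite x∈N° = refl

  keepN°ᵥ-v : keepN°ᵥ v ≡ u
  keepN°ᵥ-v rewrite inN°-v | ⌊≟⌋-yes (refl {x = v}) = refl

  keepN°ᵥ-¬N° : ∀ {x} → inN° x ≡ false → x ≢ v → keepN°ᵥ x ≡ v
  keepN°ᵥ-¬N° x∉N° x≢v rewrite x∉N° | ⌊≟⌋-no x≢v = refl

  keepN°ᵥ-dist : ∀ x y → d* (keepN°ᵥ x) (keepN°ᵥ y) ≤ d x y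
  keepN°ᵥ-dist x y = dist-contract A G* keepN°ᵥ edge-image (connected x y)
    where
    u-or-v : ∀ {x} → inN° x ≡ false → keepN°ᵥ x ≡ u ⊎ keepN°ᵥ x ≡ v
    u-or-v {x} x∉N° rewrite x∉N° with isV x
    ... | true = inj₁ refl
    ... | false = inj₂ refl
    edge-image : ∀ x z → A x z ≡ true → G* (keepN°ᵥ x) (keepN°ᵥ z) ≡ true ⊎ keepN°ᵥ x ≡ keepN°ᵥ z
    edge-image x z xz with edge-cases xz
    ... | within-M x∈M z∈M = edge-or-equal-on-u-p v-inP (u-or-v (M⇒¬N° x∈M)) (u-or-v (M⇒¬N° z∈M))
    ... | within-T x∈T z∈T = edge-or-equal-on-u-p v-inP (u-or-v (T⇒¬N° x∈T)) (u-or-v (T⇒¬N° z∈T))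
    ... | within-N x∈N z∈N = inj₁ (N-edge-image keepN°ᵥ keepN°ᵥ-v (λ _ → keepN°ᵥ-N°) x∈N z∈N xz)

  d*-≤-via : ∀ {π : Fin n → Fin n} → (∀ x y → d* (π x) (π y) ≤ d x y) →
    ∀ {x y a b} → π x ≡ a → π y ≡ b → d* a b ≤ d x y
  d*-≤-via π-dist {x} {y} πx πy = subst₂ (λ s t → d* s t ≤ d x y) πx πy (π-dist x y)

  d*-≤-from-M : ∀ {x} → inM x ≡ true → ∀ w → d* x w ≤ d x w
  d*-≤-from-M {x} x∈M w with vertex-class w
  ... | in-M w∈M = d*-≤-via contractT-dist (contractT-M x∈M) (contractT-M w∈M)
  ... | in-N° w∈N° = d*-≤-via contractT-dist (contractT-M x∈M) (contractT-N° w∈N°)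
  ... | in-P w∈T w≢u =
    d*-≤-via (keepM-dist (inP-intro w∈T w≢u)) (keepM-M x∈M) (keepM-¬M (P⇒¬M w∈T w≢u))

  d*-<-via-contractT : ∀ {x y a b} → contractT x ≡ a → contractT y ≡ b → (inM x xor inM y) ≡ true → d* a b < d x y
  d*-<-via-contractT {x} {y} πx πy crosses = subst (_≤ d x y) (+-comm _ 1)
    (subst₂ (λ s t → d* s t + 1 ≤ d x y) πx πy
      (subst (λ b → d* (contractT x) (contractT y) + 𝟙 b ≤ d x y) crosses (contractT-dist-M x y)))

  d*-<-from-M-to-N° : ∀ {x w} → inM x ≡ true → inN° w ≡ true → d* x w < d x w
  d*-<-from-M-to-N° {x} {w} x∈M w∈N° = d*-<-via-contractT (contractT-M x∈M) (contractT-N° w∈N°) crosses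
    where
    crosses : (inM x xor inM w) ≡ true
    crosses rewrite x∈M | N⇒¬M (inN°⇒inN w∈N°) = refl

  D*≤D-on-M : ∀ {x} → inM x ≡ true → D* x ≤ D x
  D*≤D-on-M x∈M = ∑-mono-≤ (d*-≤-from-M x∈M)

  D*≤D-on-N° : ∀ {x} → inN° x ≡ true → D* x ≤ D x
  D*≤D-on-N° {x} x∈N° = subst (_≤ D x) (+-identityʳ (D* x)) (∑-≤-except₂ u v 0 u≢v at-u-v elsewhere)
    where
    at-u-v : d* x u + d* x v + 0 ≤ d x u + d x v
    at-u-v = begin
        d* x u + d* x v + 0
      ≡⟨ +-identityʳ _ ⟩
        d* x u + d* x v
      ≤⟨ +-mono-≤ (d*-≤-via contractT-dist (contractT-N° x∈N°) (contractT-T v-inT))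
                  (d*-≤-via keepN°ᵥ-dist (keepN°ᵥ-N° x∈N°) (keepN°ᵥ-¬N° (M⇒¬N° u-inM) u≢v)) ⟩
        d x v + d x u
      ≡⟨ +-comm (d x v) (d x u) ⟩
        d x u + d x v ∎
      where open ≤-Reasoning
    elsewhere : ∀ w → w ≢ u → w ≢ v → d* x w ≤ d x w
    elsewhere w w≢u w≢v with vertex-class w
    ... | in-M w∈M = d*-≤-via contractT-dist (contractT-N° x∈N°) (contractT-M w∈M)
    ... | in-N° w∈N° = d*-≤-via contractT-dist (contractT-N° x∈N°) (contractT-N° w∈N°)
    ... | in-P w∈T _ = d*-≤-via (keepN°-dist (inP-intro w∈T w≢u)) (keepN°-N° x∈N°) (keepN°-T° w∈T w≢u w≢v)

  D*u≤Dv : D* u ≤ D v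
  D*u≤Dv = subst (_≤ D v) (+-identityʳ (D* u)) (∑-≤-except₂ u v 0 u≢v at-u-v elsewhere)
    where
    at-u-v : d* u u + d* u v + 0 ≤ d v u + d v v
    at-u-v = begin
        d* u u + d* u v + 0
      ≡⟨ cong (λ t → t + d* u v + 0) (d*-refl u) ⟩
        d* u v + 0
      ≡⟨ +-identityʳ _ ⟩
        d* u v
      ≤⟨ d*-uP-≤1 v-inP ⟩
        1
      ≤⟨ d-≥1 (u≢v ∘ sym) ⟩
        d v u
      ≡⟨ +-identityʳ _ ⟨
        d v u + 0
      ≡⟨ cong (d v u +_) (d-refl v) ⟨
        d v u + d v v ∎
      where open ≤-Reasoning
    elsewhere : ∀ w → w ≢ u → w ≢ v → d* u w ≤ d v w
    elsewhere w w≢u w≢v with vertex-class w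
    ... | in-M w∈M = d*-≤-via contractT-dist (contractT-T v-inT) (contractT-M w∈M)
    ... | in-N° w∈N° = d*-≤-via contractT-dist (contractT-T v-inT) (contractT-N° w∈N°)
    ... | in-P w∈T _ = d*-≤-via (keepN°-dist (inP-intro w∈T w≢u)) keepN°-v (keepN°-T° w∈T w≢u w≢v)


  -- For p ∈ T ∖ {u} and a T-neighbour q of p, the pendant edge u p of G* is paid for by the edge p q
  -- of G: with f* w = d*(u , w) + d*(p , w) and f w = d(p , w) + d(q , w), we show ∑ f* ≤ ∑ f,
  -- comparing at w = u and w = q jointly and everywhere else pointwise.
  module Pendant {p q : Fin n} (p∈P : inP p ≡ true) (q∈T : inT q ≡ true) (pq : A p q ≡ true) where

    p∈T : inT p ≡ true
    p∈T = inP⇒inT p∈P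

    p≢u : p ≢ u
    p≢u = inP⇒≢u p∈P

    p≢q : p ≢ q
    p≢q = adj⇒≢ pq

    f* f : Fin n → ℕ
    f* w = d* u w + d* p w
    f w = d p w + d q w

    f*-P-≤3 : ∀ {w} → inP w ≡ true → f* w ≤ 3
    f*-P-≤3 w∈P = +-mono-≤ (d*-uP-≤1 w∈P) (d*-PP-≤2 p∈P w∈P)

    d*-p-≤-to-M : ∀ {w} → inM w ≡ true → d* p w ≤ d p w
    d*-p-≤-to-M {w} w∈M =
      d*-≤-via (keepM-dist p∈P) (keepM-¬M (P⇒¬M p∈T p≢u)) (keepM-M w∈M)

    f*≤f-in-M : ∀ {w} → inM w ≡ true → f* w ≤ d q w + d p w
    f*≤f-in-M {w} w∈M = +-mono-≤
      (d*-≤-via contractT-dist (contractT-T q∈T) (contractT-M w∈M))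
      (d*-p-≤-to-M w∈M)

    f*≤f-in-N° : ∀ {w} → inN° w ≡ true → f* w ≤ f w
    f*≤f-in-N° {w} w∈N° with p ≟ v
    ... | no p≢v = ≤-trans (+-mono-≤
          (d*-≤-via contractT-dist (contractT-T q∈T) (contractT-N° w∈N°))
          (d*-≤-via (keepN°-dist p∈P) (keepN°-T° p∈T p≢u p≢v) (keepN°-N° w∈N°)))
        (≤-reflexive (+-comm (d q w) (d p w)))
    ... | yes refl = +-mono-≤
          (d*-≤-via contractT-dist (contractT-T v-inT) (contractT-N° w∈N°))
          (d*-≤-via keepN°ᵥ-dist (keepN°ᵥ-¬N° (T⇒¬N° q∈T) (p≢q ∘ sym)) (keepN°ᵥ-N° w∈N°))

    f*≤f-at-p : f* p ≤ f p
    f*≤f-at-p = begin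
        d* u p + d* p p
      ≡⟨ cong (d* u p +_) (d*-refl p) ⟩
        d* u p + 0
      ≡⟨ +-identityʳ _ ⟩
        d* u p
      ≤⟨ d*-uP-≤1 p∈P ⟩
        1
      ≤⟨ d-≥1 (p≢q ∘ sym) ⟩
        d q p
      ≡⟨ cong (_+ d q p) (d-refl p) ⟨
        d p p + d q p ∎
      where open ≤-Reasoning

    f*≤f : ∀ w → w ≢ u → w ≢ q → f* w ≤ f w
    f*≤f w w≢u w≢q with vertex-class w
    ... | in-M w∈M = ≤-trans (f*≤f-in-M w∈M) (≤-reflexive (+-comm (d q w) (d p w)))
    ... | in-N° w∈N° = f*≤f-in-N° w∈N°
    ... | in-P w∈T _ with w ≟ p
    ...   | yes refl = f*≤f-at-p
    ...   | no w≢p = ≤-trans (f*-P-≤3 (inP-intro w∈T w≢u))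
                       (T-edge-dist-≥3 p∈T q∈T w∈T p≢q (w≢p ∘ sym) (w≢q ∘ sym) pq)

    f*-u≤1 : f* u ≤ 1
    f*-u≤1 = subst (_≤ 1) (cong (_+ d* p u) (sym (d*-refl u))) (d*-Pu-≤1 p∈P)

    f*≤f-when-q≡u : q ≡ u → ∀ w → f* w ≤ f w
    f*≤f-when-q≡u refl w with w ≟ u
    ... | yes refl = ≤-trans f*-u≤1 (≤-trans (d-≥1 p≢u) (m≤m+n _ _))
    ... | no w≢u = f*≤f w w≢u w≢u

    f*+e≤f-at-u-q : ∀ e → q ≢ u → e + 3 ≤ d p u + d q u → f* u + f* q + e ≤ f u + f q
    f*+e≤f-at-u-q e q≢u bound = begin
        f* u + f* q + e
      ≤⟨ +-monoˡ-≤ e (+-mono-≤ f*-u≤1 (f*-P-≤3 (inP-intro q∈T q≢u))) ⟩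
        4 + e
      ≡⟨ trans (+-comm 4 e) (sym (+-assoc e 3 1)) ⟩
        e + 3 + 1
      ≤⟨ +-mono-≤ bound (d-≥1 p≢q) ⟩
        d p u + d q u + d p q
      ≡⟨ cong (d p u + d q u +_) (trans (sym (+-identityʳ (d p q))) (cong (d p q +_) (sym (d-refl q)))) ⟩
        d p u + d q u + (d p q + d q q) ∎
      where open ≤-Reasoning

    f*≤f-at-u-q : q ≢ u → f* u + f* q ≤ f u + f q
    f*≤f-at-u-q q≢u = subst (_≤ f u + f q) (+-identityʳ _)
      (f*+e≤f-at-u-q 0 q≢u (T-edge-dist-≥3 p∈T q∈T u-inT p≢q p≢u q≢u pq))

    ∑f*≤∑f : ∑ f* ≤ ∑ f
    ∑f*≤∑f with q ≟ u
    ... | yes q≡u = ∑-mono-≤ (f*≤f-when-q≡u q≡u)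
    ... | no q≢u = subst (_≤ ∑ f) (+-identityʳ (∑ f*))
          (∑-≤-except₂ u q 0 (q≢u ∘ sym) (subst (_≤ f u + f q) (sym (+-identityʳ _)) (f*≤f-at-u-q q≢u)) f*≤f)

    ∑f*<∑f-via-M : q ≢ u → ∀ {m} → inM m ≡ true → m ≢ u → ∑ f* < ∑ f
    ∑f*<∑f-via-M q≢u {m} m∈M m≢u =
      ∑-<-except₂ u q m (q≢u ∘ sym) m≢u m≢q (f*≤f-at-u-q q≢u) f*≤f strict
      where
      q∉M : inM q ≡ false
      q∉M = P⇒¬M q∈T q≢u
      m≢q : m ≢ q
      m≢q refl = true≢false m∈M q∉M
      crosses : (inM q xor inM m) ≡ true
      crosses rewrite q∉M | m∈M = refl
      closer : d* u m < d q m
      closer = d*-<-via-contractT (contractT-T q∈T) (contractT-M m∈M) crosses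
      strict : f* m < f m
      strict = begin-strict
          d* u m + d* p m
        <⟨ +-monoˡ-< (d* p m) closer ⟩
          d q m + d* p m
        ≤⟨ +-monoʳ-≤ (d q m) (d*-p-≤-to-M m∈M) ⟩
          d q m + d p m
        ≡⟨ +-comm (d q m) (d p m) ⟩
          d p m + d q m ∎
        where open ≤-Reasoning

    ∑f*<∑f-via-u : q ≢ u → 1 + 3 ≤ d p u + d q u → ∑ f* < ∑ f
    ∑f*<∑f-via-u q≢u bound = subst (_≤ ∑ f) (+-comm (∑ f*) 1)
      (∑-≤-except₂ u q 1 (q≢u ∘ sym) (f*+e≤f-at-u-q 1 q≢u bound) f*≤f)

    f*<f-in-P : ∀ {w} → inP w ≡ true → 4 ≤ f w → f* w < f w
    f*<f-in-P w∈P bound = ≤-trans (s≤s (f*-P-≤3 w∈P)) bound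

    ∑f*<∑f-via-T : ∀ {w} → inT w ≡ true → w ≢ u → w ≢ q → 4 ≤ f w → ∑ f* < ∑ f
    ∑f*<∑f-via-T {w} w∈T w≢u w≢q bound with q ≟ u
    ... | yes q≡u = ∑-mono-< w (f*≤f-when-q≡u q≡u) (f*<f-in-P (inP-intro w∈T w≢u) bound)
    ... | no q≢u = ∑-<-except₂ u q w (q≢u ∘ sym) w≢u w≢q (f*≤f-at-u-q q≢u) f*≤f
                     (f*<f-in-P (inP-intro w∈T w≢u) bound)

  A[T] : Graph n
  A[T] x y = inT x ∧ inT y ∧ A x y

  module DT = Distance A[T]

  walkIn-T⇒walk : ∀ {x y} → WalkIn A T x y → Σ ℕ (λ k → DT.Walk k x y)
  walkIn-T⇒walk (here _) = 0 , DT.walk-refl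
  walkIn-T⇒walk (step x∈T xz w) with walkIn-T⇒walk w
  ... | k , w′ = suc k , DT.walk-∷ (∧-intro (∈⇒true x∈T) (∧-intro (∈⇒true (source w)) xz)) w′
    where
    source : ∀ {x y} → WalkIn A T x y → x ∈ T
    source (here x∈T) = x∈T
    source (step x∈T _ _) = x∈T

  T-walk-to-u : ∀ {p} → inT p ≡ true → Σ ℕ (λ k → DT.Walk k p u)
  T-walk-to-u p∈T = walkIn-T⇒walk (proj₂ (proj₁ T-tree) _ u (true⇒∈ p∈T) u∈T)

  height : Fin n → ℕ
  height x = dist A[T] x u

  height≡0⇒u : ∀ {x} → inT x ≡ true → height x ≡ 0 → x ≡ u
  height≡0⇒u x∈T h≡0 = DT.walk₀⇒≡ (subst (λ k → DT.Walk k _ u) h≡0 (DT.dist-walk (proj₂ (T-walk-to-u x∈T))))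

  height-P-pos : ∀ {p} → inP p ≡ true → 0 < height p
  height-P-pos p∈P = DT.dist-≥1 (proj₂ (T-walk-to-u (inP⇒inT p∈P))) (inP⇒≢u p∈P)

  IsParent : Fin n → Fin n → Set
  IsParent p z = A[T] p z ≡ true × height z < height p

  parent-exists : ∀ {p} → inP p ≡ true → Σ (Fin n) (IsParent p)
  parent-exists {p} p∈P with height p in h≡ | DT.dist-walk (proj₂ (T-walk-to-u (inP⇒inT p∈P)))
  ... | zero | _ = ⊥-elim (<-irrefl (sym h≡) (height-P-pos p∈P))
  ... | suc k | w with DT.walk-uncons {k} w
  ...   | z , pz , w′ = z , pz , s≤s (DT.dist-≤-walk w′)

  -- The vertex of T adjacent to p on the path from p to u; junk u when p ∉ T ∖ {u}.
  parent : Fin n → Fin n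
  parent p with Fin.any? (λ z → (A[T] p z Bool.≟ true) ×-dec (height z <? height p))
  ... | yes (z , _) = z
  ... | no _ = u

  parent-isParent : ∀ {p} → inP p ≡ true → IsParent p (parent p)
  parent-isParent {p} p∈P with Fin.any? (λ z → (A[T] p z Bool.≟ true) ×-dec (height z <? height p))
  ... | yes (_ , z-parent) = z-parent
  ... | no none = ⊥-elim (none (parent-exists p∈P))

  parent-inT : ∀ {p} → inP p ≡ true → inT (parent p) ≡ true
  parent-inT {p} p∈P = ∧-elimˡ (∧-elimʳ {inT p} (proj₁ (parent-isParent p∈P)))

  parent-adj : ∀ {p} → inP p ≡ true → A p (parent p) ≡ true
  parent-adj {p} p∈P = ∧-elimʳ {inT (parent p)} (∧-elimʳ {inT p} (proj₁ (parent-isParent p∈P)))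

  parent-of-u-neighbour : ∀ {p} → inP p ≡ true → A p u ≡ true → parent p ≡ u
  parent-of-u-neighbour {p} p∈P pu = height≡0⇒u (parent-inT p∈P)
    (n<1⇒n≡0 (<-≤-trans (proj₂ (parent-isParent p∈P))
      (DT.dist-≤1 (∧-intro (inP⇒inT p∈P) (∧-intro u-inT pu)))))

  𝟙P : Fin n → ℕ
  𝟙P x = 𝟙 (inP x)

  A[T]-symm : ∀ a b → A[T] b a ≡ A[T] a b
  A[T]-symm a b rewrite symm b a with inT a | inT b
  ... | true | true = refl
  ... | true | false = refl
  ... | false | true = refl
  ... | false | false = refl

  parent-edge : ∀ {p} → inP p ≡ true → 𝟙 (A[T] p (parent p)) ≡ 1
  parent-edge p∈P = cong 𝟙 (proj₁ (parent-isParent p∈P))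

  parent-edge′ : ∀ {p} → inP p ≡ true → 𝟙 (A[T] (parent p) p) ≡ 1
  parent-edge′ {p} p∈P = trans (cong 𝟙 (A[T]-symm p (parent p))) (parent-edge p∈P)

  -- Each edge of T is the edge from its endpoint farther from u to that endpoint's parent.
  parent-edges-≤-T-edge : ∀ x z → 𝟙P x * δ (parent x) z + 𝟙P z * δ (parent z) x ≤ 𝟙 (A[T] x z)
  parent-edges-≤-T-edge x z with bool-cases (inP x) | bool-cases (inP z)
  ... | inj₁ x∈P | inj₁ z∈P = both (z ≟ parent x) (x ≟ parent z)
    where
    both : Dec (z ≡ parent x) → Dec (x ≡ parent z) →
      𝟙P x * δ (parent x) z + 𝟙P z * δ (parent z) x ≤ 𝟙 (A[T] x z)
    both (yes z≡) (yes x≡) = ⊥-elim (<-asym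
      (subst (λ t → height t < height x) (sym z≡) (proj₂ (parent-isParent x∈P)))
      (subst (λ t → height t < height z) (sym x≡) (proj₂ (parent-isParent z∈P))))
    both (yes refl) (no x≢) rewrite x∈P | z∈P | δ-off x≢ | δ-diag (parent x) | parent-edge x∈P = ≤-refl
    both (no z≢) (yes refl) rewrite x∈P | z∈P | δ-off z≢ | δ-diag (parent z) = ≤-reflexive (sym (parent-edge′ z∈P))
    both (no z≢) (no x≢) rewrite x∈P | z∈P | δ-off z≢ | δ-off x≢ = z≤n
  ... | inj₁ x∈P | inj₂ z∉P rewrite x∈P | z∉P with z ≟ parent x
  ...   | yes refl rewrite parent-edge x∈P = ≤-refl
  ...   | no _ = z≤n
  parent-edges-≤-T-edge x z | inj₂ x∉P | inj₁ z∈P rewrite x∉P | z∈P with x ≟ parent z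
  ...   | yes refl = ≤-reflexive (sym (parent-edge′ z∈P))
  ...   | no _ = z≤n
  parent-edges-≤-T-edge x z | inj₂ x∉P | inj₂ z∉P rewrite x∉P | z∉P = z≤n

  ∑-parent-edges-≤-∑-T-edges : (E : Fin n → ℕ) → ∑ (λ p → 𝟙P p * (E p + E (parent p))) ≤ ∑-edges A[T] E
  ∑-parent-edges-≤-∑-T-edges E = begin
      ∑ (λ p → 𝟙P p * (E p + E (parent p)))
    ≡⟨ sum-cong-≗ (λ p → *-distribˡ-+ (𝟙P p) (E p) (E (parent p))) ⟩
      ∑ (λ p → 𝟙P p * E p + 𝟙P p * E (parent p))
    ≡⟨ ∑-distrib-+ (λ p → 𝟙P p * E p) (λ p → 𝟙P p * E (parent p)) ⟩
      ∑ (λ x → 𝟙P x * E x) + ∑ (λ z → 𝟙P z * E (parent z))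
    ≡⟨ cong₂ _+_ (sum-cong-≗ (λ x → sym (∑-δ-* (parent x) (λ _ → 𝟙P x * E x))))
                 (sum-cong-≗ (λ z → sym (∑-δ-* (parent z) (λ x → 𝟙P z * E x)))) ⟩
      ∑ (λ x → ∑ (as-child x)) + ∑ (λ z → ∑ (λ x → as-parent x z))
    ≡⟨ cong (∑ (λ x → ∑ (as-child x)) +_) (∑-comm (λ z x → as-parent x z)) ⟩
      ∑ (λ x → ∑ (as-child x)) + ∑ (λ x → ∑ (as-parent x))
    ≡⟨ ∑∑-distrib-+ as-child as-parent ⟨
      ∑ (λ x → ∑ (λ z → as-child x z + as-parent x z))
    ≡⟨ sum-cong-≗ (λ x → sum-cong-≗ (λ z → factor (δ (parent x) z) (𝟙P x) (δ (parent z) x) (𝟙P z) (E x))) ⟩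
      ∑ (λ x → ∑ (λ z → (𝟙P x * δ (parent x) z + 𝟙P z * δ (parent z) x) * E x))
    ≤⟨ ∑-weighted-mono-≤ E parent-edges-≤-T-edge ⟩
      ∑-edges A[T] E ∎
    where
    open ≤-Reasoning
    as-child as-parent : Fin n → Fin n → ℕ
    as-child x z = δ (parent x) z * (𝟙P x * E x)
    as-parent x z = δ (parent z) x * (𝟙P z * E x)
    factor : ∀ a b c e k → a * (b * k) + c * (e * k) ≡ (b * a + e * c) * k
    factor = solve-∀

  evN° eN°v : Fin n → Fin n → Bool
  evN° x z = isV x ∧ inN° z ∧ A x z
  eN°v x z = inN° x ∧ isV z ∧ A x z

  edge-parts-≤-edge : ∀ x z →
    𝟙 (eM x z) + 𝟙 (eN° x z) + 𝟙 (evN° x z) + 𝟙 (eN°v x z) + 𝟙 (A[T] x z) ≤ 𝟙 (A x z)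
  edge-parts-≤-edge x z with bool-cases (A x z)
  ... | inj₂ ¬xz = ≤-by-parts (no-edge (inM x) (inM z)) (no-edge (inN° x) (inN° z)) (no-edge (isV x) (inN° z))
                              (no-edge (inN° x) (isV z)) (no-edge (inT x) (inT z)) z≤n
    where
    no-edge : ∀ a b → 𝟙 (a ∧ b ∧ A x z) ≡ 0
    no-edge a b = 𝟙-∧₃-false a b (λ _ _ xz → true≢false xz ¬xz)
  ... | inj₁ xz with edge-cases xz
  ...   | within-M x∈M z∈M = ≤-by-parts
          (𝟙-∧-true x∈M (∧-intro z∈M xz)) (𝟙-∧-falseˡ _ (M⇒¬N° x∈M))
          (𝟙-∧-falseˡ _ (⌊≟⌋-no (M⇒≢v x∈M))) (𝟙-∧-falseˡ _ (M⇒¬N° x∈M))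
          (𝟙-∧₃-false (inT x) (inT z) (M∩T-edge-⊥ x∈M z∈M)) (𝟙-≥1 xz)
  ...   | within-T x∈T z∈T = ≤-by-parts
          (𝟙-∧₃-false (inM x) (inM z) (λ x∈M z∈M → M∩T-edge-⊥ x∈M z∈M x∈T z∈T)) (𝟙-∧-falseˡ _ (T⇒¬N° x∈T))
          (𝟙-∧-falseʳ (isV x) (∧-falseˡ (T⇒¬N° z∈T))) (𝟙-∧-falseˡ _ (T⇒¬N° x∈T))
          (𝟙-∧-true x∈T (∧-intro z∈T xz)) (𝟙-≥1 xz)
  ...   | within-N x∈N z∈N with N-cases x∈N | N-cases z∈N
  ...     | inj₁ refl | inj₁ refl = ⊥-elim (adj⇒≢ xz refl)
  ...     | inj₁ refl | inj₂ z∈N° = ≤-by-parts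
            (𝟙-∧-falseˡ _ (N⇒¬M x∈N)) (𝟙-∧-falseˡ _ inN°-v)
            (𝟙-∧-true (⌊≟⌋-yes (refl {x = v})) (∧-intro z∈N° xz)) (𝟙-∧-falseˡ _ inN°-v)
            (𝟙-∧-falseʳ (inT v) (∧-falseˡ (inN°⇒¬T z∈N°))) (𝟙-≥1 xz)
  ...     | inj₂ x∈N° | inj₁ refl = ≤-by-parts
            (𝟙-∧-falseˡ _ (N⇒¬M x∈N)) (𝟙-∧-falseʳ (inN° x) (∧-falseˡ inN°-v))
            (𝟙-∧-falseˡ _ (⌊≟⌋-no (inN°⇒≢v x∈N°))) (𝟙-∧-true x∈N° (∧-intro (⌊≟⌋-yes (refl {x = v})) xz))
            (𝟙-∧-falseˡ _ (inN°⇒¬T x∈N°)) (𝟙-≥1 xz)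
  ...     | inj₂ x∈N° | inj₂ z∈N° = ≤-by-parts
            (𝟙-∧-falseˡ _ (N⇒¬M x∈N)) (𝟙-∧-true x∈N° (∧-intro z∈N° xz))
            (𝟙-∧-falseˡ _ (⌊≟⌋-no (inN°⇒≢v x∈N°))) (𝟙-∧-falseʳ (inN° x) (∧-falseˡ (⌊≟⌋-no (inN°⇒≢v z∈N°))))
            (𝟙-∧-falseˡ _ (inN°⇒¬T x∈N°)) (𝟙-≥1 xz)

  DD DD* : ℕ
  DD = ∑-edges A D
  DD* = ∑-edges G* D*

  DD≡ : degreeDistance A ≡ DD
  DD≡ = degreeDistance≡∑-edges A

  DD*≡ : degreeDistance G* ≡ DD*
  DD*≡ = degreeDistance≡∑-edges G*

  DD-≥-parts : ∑-edges eM D + ∑-edges eN° D + ∑-edges evN° D + ∑-edges eN°v D + ∑-edges A[T] D ≤ DD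
  DD-≥-parts = subst (_≤ DD)
    (sym (∑-weighted-+₅ (λ x z → 𝟙 (eM x z)) (λ x z → 𝟙 (eN° x z)) (λ x z → 𝟙 (evN° x z))
                        (λ x z → 𝟙 (eN°v x z)) (λ x z → 𝟙 (A[T] x z)) D))
    (∑-weighted-mono-≤ D edge-parts-≤-edge)

  DD*-≤-parts : DD* ≤ ∑-edges eM D* + (∑-edges eN° D* + (∑-edges euN° D* + (∑-edges eN°u D*
                      + (∑-edges euP D* + ∑-edges ePu D*))))
  DD*-≤-parts =
    ≤-trans (∑-edges-∨ eM _ D*) (+-monoʳ-≤ (∑-edges eM D*)
    (≤-trans (∑-edges-∨ eN° _ D*) (+-monoʳ-≤ (∑-edges eN° D*)
    (≤-trans (∑-edges-∨ euN° _ D*) (+-monoʳ-≤ (∑-edges euN° D*)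
    (≤-trans (∑-edges-∨ eN°u _ D*) (+-monoʳ-≤ (∑-edges eN°u D*) (∑-edges-∨ euP ePu D*))))))))

  M-edges-≤ : ∑-edges eM D* ≤ ∑-edges eM D
  M-edges-≤ = ∑∑-mono-≤ (λ x z → 𝟙-*-mono-≤ (eM x z) (λ e → D*≤D-on-M (∧-elimˡ e)))

  N°-edges-≤ : ∑-edges eN° D* ≤ ∑-edges eN° D
  N°-edges-≤ = ∑∑-mono-≤ (λ x z → 𝟙-*-mono-≤ (eN° x z) (λ e → D*≤D-on-N° (∧-elimˡ e)))

  uN°-edges-≤ : ∑-edges euN° D* ≤ ∑-edges evN° D
  uN°-edges-≤ = subst₂ _≤_
    (sym (∑-edges-from u (λ _ z → inN° z ∧ A v z) D*)) (sym (∑-edges-from v (λ x z → inN° z ∧ A x z) D))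
    (*-monoʳ-≤ (∑ (λ z → 𝟙 (inN° z ∧ A v z))) D*u≤Dv)

  N°u-edges-≤ : ∑-edges eN°u D* ≤ ∑-edges eN°v D
  N°u-edges-≤ = subst₂ _≤_
    (sym (∑-edges-to u inN° (λ x _ → A x v) D*)) (sym (∑-edges-to v inN° A D))
    (∑-mono-≤ (λ x → 𝟙-*-mono-≤ (inN° x ∧ A x v) (λ x∈N°∧xv → D*≤D-on-N° (∧-elimˡ x∈N°∧xv))))

  pendant-sum* : ℕ
  pendant-sum* = ∑ (λ p → 𝟙P p * (D* u + D* p))

  pendant-edges*≡ : ∑-edges euP D* + ∑-edges ePu D* ≡ pendant-sum*
  pendant-edges*≡ = begin
      ∑-edges euP D* + ∑-edges ePu D*
    ≡⟨ cong₂ _+_ (∑-edges-from u (λ _ z → inP z) D*)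
                 (trans (sum-cong-≗ (λ x → sum-cong-≗ (λ z → cong (λ b → 𝟙 (inP x ∧ b) * D* x) (sym (Bool.∧-identityʳ (isU z))))))
                        (∑-edges-to u inP (λ _ _ → true) D*)) ⟩
      ∑ 𝟙P * D* u + ∑ (λ p → 𝟙 (inP p ∧ true) * D* p)
    ≡⟨ cong₂ _+_ (*-distribʳ-sum (D* u) 𝟙P) (sum-cong-≗ (λ p → cong (λ b → 𝟙 b * D* p) (Bool.∧-identityʳ (inP p)))) ⟩
      ∑ (λ p → 𝟙P p * D* u) + ∑ (λ p → 𝟙P p * D* p)
    ≡⟨ ∑-distrib-+ (λ p → 𝟙P p * D* u) (λ p → 𝟙P p * D* p) ⟨
      ∑ (λ p → 𝟙P p * D* u + 𝟙P p * D* p)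
    ≡⟨ sum-cong-≗ (λ p → sym (*-distribˡ-+ (𝟙P p) (D* u) (D* p))) ⟩
      pendant-sum* ∎
    where open ≡-Reasoning

  pendant-pair-≤ : ∀ {p} → inP p ≡ true → D* u + D* p ≤ D p + D (parent p)
  pendant-pair-≤ {p} p∈P = subst₂ _≤_ (∑-distrib-+ (d* u) (d* p)) (∑-distrib-+ (d p) (d (parent p)))
    (Pendant.∑f*≤∑f p∈P (parent-inT p∈P) (parent-adj p∈P))

  parent-sum : ℕ
  parent-sum = ∑ (λ p → 𝟙P p * (D p + D (parent p)))

  pendant-sum*≤parent-sum : pendant-sum* ≤ parent-sum
  pendant-sum*≤parent-sum = ∑-mono-≤ (λ p → 𝟙-*-mono-≤ (inP p) pendant-pair-≤)

  DD*+slack≤DD : ∀ sM sP → ∑-edges eM D* + sM ≤ ∑-edges eM D → pendant-sum* + sP ≤ parent-sum →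
    DD* + sM + sP ≤ DD
  DD*+slack≤DD sM sP M-bound P-bound = begin
      DD* + sM + sP
    ≤⟨ +-monoˡ-≤ sP (+-monoˡ-≤ sM DD*-≤-parts) ⟩
      m* + (n* + (un* + (nu* + (up* + pu*)))) + sM + sP
    ≡⟨ regroup m* n* un* nu* up* pu* sM sP ⟩
      (m* + sM) + n* + un* + nu* + ((up* + pu*) + sP)
    ≡⟨ cong (λ t → (m* + sM) + n* + un* + nu* + (t + sP)) pendant-edges*≡ ⟩
      (m* + sM) + n* + un* + nu* + (pendant-sum* + sP)
    ≤⟨ +-mono-≤ (+-mono-≤ (+-mono-≤ (+-mono-≤ M-bound N°-edges-≤) uN°-edges-≤) N°u-edges-≤)
                (≤-trans P-bound (∑-parent-edges-≤-∑-T-edges D)) ⟩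
      ∑-edges eM D + ∑-edges eN° D + ∑-edges evN° D + ∑-edges eN°v D + ∑-edges A[T] D
    ≤⟨ DD-≥-parts ⟩
      DD ∎
    where
    open ≤-Reasoning
    m* n* un* nu* up* pu* : ℕ
    m* = ∑-edges eM D*
    n* = ∑-edges eN° D*
    un* = ∑-edges euN° D*
    nu* = ∑-edges eN°u D*
    up* = ∑-edges euP D*
    pu* = ∑-edges ePu D*
    regroup : ∀ a b c d e f x y → a + (b + (c + (d + (e + f)))) + x + y ≡ (a + x) + b + c + d + ((e + f) + y)
    regroup = solve-∀

  DD*<DD⇒ : DD* < DD → degreeDistance G* < degreeDistance A
  DD*<DD⇒ = subst₂ _<_ (sym DD*≡) (sym DD≡)

  module ParentPendant {p : Fin n} (p∈P : inP p ≡ true) = Pendant p∈P (parent-inT p∈P) (parent-adj p∈P)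

  ∑f*<∑f⇒DD*<DD : ∀ {p} (p∈P : inP p ≡ true) →
    ∑ (ParentPendant.f* p∈P) < ∑ (ParentPendant.f p∈P) → DD* < DD
  ∑f*<∑f⇒DD*<DD {p} p∈P lt = subst (_≤ DD) (trans (cong (_+ 1) (+-identityʳ DD*)) (+-comm DD* 1))
    (DD*+slack≤DD 0 1 (subst (_≤ ∑-edges eM D) (sym (+-identityʳ _)) M-edges-≤)
      (subst (_≤ parent-sum) (+-comm 1 pendant-sum*)
        (∑-mono-< p (λ x → 𝟙-*-mono-≤ (inP x) pendant-pair-≤) strict)))
    where
    strict : 𝟙P p * (D* u + D* p) < 𝟙P p * (D p + D (parent p))
    strict rewrite p∈P | *-identityˡ (D* u + D* p) | *-identityˡ (D p + D (parent p)) =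
      subst₂ _<_ (∑-distrib-+ (d* u) (d* p)) (∑-distrib-+ (d p) (d (parent p))) lt

  u-has-M-neighbour : ∀ {m} → inM m ≡ true → m ≢ u → Σ (Fin n) (λ z → inM z ≡ true × A u z ≡ true)
  u-has-M-neighbour m∈M m≢u with proj₂ M-conn u _ u∈M (true⇒∈ m∈M)
  ... | here _ = ⊥-elim (m≢u refl)
  ... | step _ uz w = _ , ∈⇒true (source w) , uz
    where
    source : ∀ {x y} → WalkIn A M x y → x ∈ M
    source (here x∈M) = x∈M
    source (step x∈M _ _) = x∈M

  M-edges-< : ∀ {z} → inM z ≡ true → A u z ≡ true → D* u < D u → ∑-edges eM D* + 1 ≤ ∑-edges eM D
  M-edges-< {z} z∈M uz D*u<Du = subst (_≤ ∑-edges eM D) (+-comm 1 (∑-edges eM D*))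
    (∑-mono-< u (λ x → ∑-mono-≤ (λ z → on-M-edges x z))
      (∑-mono-< z (on-M-edges u) strict))
    where
    on-M-edges : ∀ x z → 𝟙 (eM x z) * D* x ≤ 𝟙 (eM x z) * D x
    on-M-edges x z = 𝟙-*-mono-≤ (eM x z) (λ xz → D*≤D-on-M (∧-elimˡ xz))
    strict : 𝟙 (eM u z) * D* u < 𝟙 (eM u z) * D u
    strict rewrite ∧-intro u-inM (∧-intro z∈M uz) | *-identityˡ (D* u) | *-identityˡ (D u) = D*u<Du

  DD*<DD-if-M-and-N-large : 3 ≤ ∣ M ∣ → 3 ≤ ∣ N ∣ → DD* < DD
  DD*<DD-if-M-and-N-large 3≤∣M∣ 3≤∣N∣
    with ∃-other-element M u (≤-trans (n≤1+n 2) 3≤∣M∣) | ∃-other-element N v (≤-trans (n≤1+n 2) 3≤∣N∣)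
  ... | m , m∈M , m≢u | w , w∈N , w≢v with u-has-M-neighbour m∈M m≢u
  ...   | z , z∈M , uz = subst (_≤ DD) (trans (+-identityʳ (DD* + 1)) (+-comm DD* 1))
          (DD*+slack≤DD 1 0 (M-edges-< z∈M uz D*u<Du) (subst (_≤ parent-sum) (sym (+-identityʳ pendant-sum*)) pendant-sum*≤parent-sum))
    where
    D*u<Du : D* u < D u
    D*u<Du = ∑-mono-< w (d*-≤-from-M u-inM) (d*-<-from-M-to-N° u-inM (inN°-intro w∈N w≢v))

module SingletonN {n : ℕ} (A : Graph n) (g : Gluing A) (∣N∣≡1 : ∣ Gluing.N g ∣ ≡ 1) where
  open Configuration A g

  N⇒v : ∀ y → inN y ≡ true → y ≡ v
  N⇒v = singleton-unique N v v-inN ∣N∣≡1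

  ¬N° : ∀ y → inN° y ≡ false
  ¬N° y with bool-cases (inN y)
  ... | inj₁ y∈N rewrite N⇒v y y∈N = inN°-v
  ... | inj₂ y∉N = ∧-falseˡ y∉N

  G*-edge-cases : ∀ x y → G* x y ≡ true →
    (inM x ≡ true × inM y ≡ true × A x y ≡ true) ⊎ (x ≡ u × inP y ≡ true) ⊎ (inP x ≡ true × y ≡ u)
  G*-edge-cases x y xy with ∨-elim (eM x y) xy
  ... | inj₁ M-edge =
    inj₁ (∧-elimˡ M-edge , ∧-elimˡ (∧-elimʳ {inM x} M-edge) , ∧-elimʳ {inM y} (∧-elimʳ {inM x} M-edge))
  ... | inj₂ xy₁ with ∨-elim (eN° x y) xy₁
  ...   | inj₁ N°-edge = ⊥-elim (true≢false (∧-elimˡ N°-edge) (¬N° x))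
  ...   | inj₂ xy₂ with ∨-elim (euN° x y) xy₂
  ...     | inj₁ uN°-edge = ⊥-elim (true≢false (∧-elimˡ (∧-elimʳ {isU x} uN°-edge)) (¬N° y))
  ...     | inj₂ xy₃ with ∨-elim (eN°u x y) xy₃
  ...       | inj₁ N°u-edge = ⊥-elim (true≢false (∧-elimˡ N°u-edge) (¬N° x))
  ...       | inj₂ xy₄ with ∨-elim (euP x y) xy₄
  ...         | inj₁ uP-edge = inj₂ (inj₁ (⌊≟⌋-sound (∧-elimˡ uP-edge) , ∧-elimʳ {isU x} uP-edge))
  ...         | inj₂ Pu-edge = inj₂ (inj₂ (∧-elimˡ Pu-edge , ⌊≟⌋-sound (∧-elimʳ {inP x} Pu-edge)))

  iso-if-T-star-at-u : (∀ p → inP p ≡ true → A p u ≡ true) → Isomorphic A (gStar g)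
  iso-if-T-star-at-u star = (λ x → x) , ((λ eq → eq) , (λ y → y , (λ eq → eq))) , (λ x y → bool-≡ (to-G* x y) (to-G x y))
    where
    to-G* : ∀ x y → A x y ≡ true → G* x y ≡ true
    to-G* x y xy with edge-cases xy
    ... | within-M x∈M y∈M = G*-M x∈M y∈M xy
    ... | within-N x∈N y∈N = ⊥-elim (adj⇒≢ xy (trans (N⇒v x x∈N) (sym (N⇒v y y∈N))))
    ... | within-T x∈T y∈T = T-edge (x ≟ u) (y ≟ u)
      where
      T-edge : Dec (x ≡ u) → Dec (y ≡ u) → G* x y ≡ true
      T-edge (yes refl) _ = G*-uP (inP-intro y∈T (adj⇒≢ xy ∘ sym))
      T-edge (no x≢u) (yes refl) = G*-Pu (inP-intro x∈T x≢u)
      T-edge (no x≢u) (no y≢u) = ⊥-elim (no-triangle x∈T y∈T u-inT (adj⇒≢ xy) x≢u y≢u xy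
        (star y (inP-intro y∈T y≢u)) (trans (symm u x) (star x (inP-intro x∈T x≢u))))
    to-G : ∀ x y → G* x y ≡ true → A x y ≡ true
    to-G x y xy with G*-edge-cases x y xy
    ... | inj₁ (_ , _ , xy′) = xy′
    ... | inj₂ (inj₁ (refl , y∈P)) = trans (symm u y) (star y y∈P)
    ... | inj₂ (inj₂ (x∈P , refl)) = star x x∈P

  all-in-T : (∀ x → inM x ≡ true → x ≡ u) → ∀ x → inT x ≡ true
  all-in-T M⇒u x with cover x
  ... | inj₁ x∈M rewrite M⇒u x (∈⇒true x∈M) = u-inT
  ... | inj₂ (inj₁ x∈T) = ∈⇒true x∈T
  ... | inj₂ (inj₂ x∈N) rewrite N⇒v x (∈⇒true x∈N) = v-inT

  OneEndAt : Fin n → Fin n → Fin n → Set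
  OneEndAt c x y = (x ≡ c × y ≢ c) ⊎ (x ≢ c × y ≡ c)

  -- With M = {u} the edges of G* are those with exactly one end u, and those of a star T centred
  -- at c are those with exactly one end c; transposing u and c matches them.
  module StarAt (M⇒u : ∀ x → inM x ≡ true → x ≡ u) {c : Fin n} (c∈P : inP c ≡ true)
                (star : ∀ w → w ≢ c → A w c ≡ true) where

    c≢u : c ≢ u
    c≢u = inP⇒≢u c∈P

    swap : Fin n → Fin n
    swap x = if ⌊ x ≟ u ⌋ then c else (if ⌊ x ≟ c ⌋ then u else x)

    swap-u : swap u ≡ c
    swap-u rewrite isU-u = refl

    swap-c : swap c ≡ u
    swap-c rewrite ⌊≟⌋-no c≢u | ⌊≟⌋-yes (refl {x = c}) = refl

    swap-other : ∀ {x} → x ≢ u → x ≢ c → swap x ≡ x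
    swap-other x≢u x≢c rewrite ⌊≟⌋-no x≢u | ⌊≟⌋-no x≢c = refl

    swap-cases : ∀ x → (x ≡ u) ⊎ (x ≡ c) ⊎ (x ≢ u × x ≢ c)
    swap-cases x with x ≟ u | x ≟ c
    ... | yes x≡u | _ = inj₁ x≡u
    ... | no _ | yes x≡c = inj₂ (inj₁ x≡c)
    ... | no x≢u | no x≢c = inj₂ (inj₂ (x≢u , x≢c))

    swap≡u⇔≡c : ∀ {x} → (swap x ≡ u → x ≡ c) × (x ≡ c → swap x ≡ u)
    swap≡u⇔≡c {x} with swap-cases x
    ... | inj₁ refl = (λ c≡u → ⊥-elim (c≢u (trans (sym swap-u) c≡u))) , (λ u≡c → ⊥-elim (c≢u (sym u≡c)))
    ... | inj₂ (inj₁ refl) = (λ _ → refl) , (λ _ → swap-c)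
    ... | inj₂ (inj₂ (x≢u , x≢c)) = (λ x↦u → ⊥-elim (x≢u (trans (sym (swap-other x≢u x≢c)) x↦u))) , (λ x≡c → ⊥-elim (x≢c x≡c))

    swap-involutive : ∀ x → swap (swap x) ≡ x
    swap-involutive x with swap-cases x
    ... | inj₁ refl = trans (cong swap swap-u) swap-c
    ... | inj₂ (inj₁ refl) = trans (cong swap swap-c) swap-u
    ... | inj₂ (inj₂ (x≢u , x≢c)) = trans (cong swap (swap-other x≢u x≢c)) (swap-other x≢u x≢c)

    swap-OneEnd : ∀ {x y} → OneEndAt c x y → OneEndAt u (swap x) (swap y)
    swap-OneEnd (inj₁ (x≡c , y≢c)) = inj₁ (proj₂ swap≡u⇔≡c x≡c , y≢c ∘ proj₁ swap≡u⇔≡c)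
    swap-OneEnd (inj₂ (x≢c , y≡c)) = inj₂ (x≢c ∘ proj₁ swap≡u⇔≡c , proj₂ swap≡u⇔≡c y≡c)

    swap-OneEnd⁻ : ∀ {x y} → OneEndAt u (swap x) (swap y) → OneEndAt c x y
    swap-OneEnd⁻ (inj₁ (x↦u , y↦≢u)) = inj₁ (proj₁ swap≡u⇔≡c x↦u , y↦≢u ∘ proj₂ swap≡u⇔≡c)
    swap-OneEnd⁻ (inj₂ (x↦≢u , y↦u)) = inj₂ (x↦≢u ∘ proj₂ swap≡u⇔≡c , proj₁ swap≡u⇔≡c y↦u)

    G*-OneEnd : ∀ {x y} → G* x y ≡ true → OneEndAt u x y
    G*-OneEnd {x} {y} xy with G*-edge-cases x y xy
    ... | inj₁ (x∈M , y∈M , xy′) = ⊥-elim (adj⇒≢ xy′ (trans (M⇒u x x∈M) (sym (M⇒u y y∈M))))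
    ... | inj₂ (inj₁ (x≡u , y∈P)) = inj₁ (x≡u , inP⇒≢u y∈P)
    ... | inj₂ (inj₂ (x∈P , y≡u)) = inj₂ (inP⇒≢u x∈P , y≡u)

    OneEnd-G* : ∀ {x y} → OneEndAt u x y → G* x y ≡ true
    OneEnd-G* {y = y} (inj₁ (refl , y≢u)) = G*-uP (inP-intro (all-in-T M⇒u y) y≢u)
    OneEnd-G* {x = x} (inj₂ (x≢u , refl)) = G*-Pu (inP-intro (all-in-T M⇒u x) x≢u)

    A-OneEnd : ∀ {x y} → A x y ≡ true → OneEndAt c x y
    A-OneEnd {x} {y} xy with x ≟ c | y ≟ c
    ... | yes x≡c | _ = inj₁ (x≡c , (λ y≡c → adj⇒≢ xy (trans x≡c (sym y≡c))))
    ... | no x≢c | yes y≡c = inj₂ (x≢c , y≡c)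
    ... | no x≢c | no y≢c = ⊥-elim (no-triangle (all-in-T M⇒u x) (all-in-T M⇒u y) (all-in-T M⇒u c)
            (adj⇒≢ xy) x≢c y≢c xy (star y y≢c) (trans (symm c x) (star x x≢c)))

    OneEnd-A : ∀ {x y} → OneEndAt c x y → A x y ≡ true
    OneEnd-A {x} {y} (inj₁ (refl , y≢c)) = trans (symm x y) (star y y≢c)
    OneEnd-A (inj₂ (x≢c , refl)) = star _ x≢c

    iso-by-swap : Isomorphic A (gStar g)
    iso-by-swap = swap , (injective , surjective) ,
      (λ x y → bool-≡ (OneEnd-G* ∘ swap-OneEnd ∘ A-OneEnd) (OneEnd-A ∘ swap-OneEnd⁻ ∘ G*-OneEnd))
      where
      injective : ∀ {x y} → swap x ≡ swap y → x ≡ y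
      injective {x} {y} eq = trans (sym (swap-involutive x)) (trans (cong swap eq) (swap-involutive y))
      surjective : ∀ y → Σ (Fin n) (λ x → ∀ {z} → z ≡ x → swap z ≡ y)
      surjective y = swap y , (λ { refl → swap-involutive y })


module SingletonN-NonIsomorphic {n : ℕ} (A : Graph n) (g : Gluing A) (∣N∣≡1 : ∣ Gluing.N g ∣ ≡ 1)
             (G≇G* : ¬ Isomorphic A (gStar g)) where
  open Configuration A g
  open SingletonN A g ∣N∣≡1

  star-or-non-neighbour : ∀ c → (∀ w → w ≢ c → A w c ≡ true) ⊎ Σ (Fin n) (λ w → w ≢ c × A w c ≡ false)
  star-or-non-neighbour c with Fin.any? (λ w → ¬? (w ≟ c) ×-dec (A w c Bool.≟ false))
  ... | yes witness = inj₂ witness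
  ... | no none = inj₁ star
    where
    star : ∀ w → w ≢ c → A w c ≡ true
    star w w≢c with bool-cases (A w c)
    ... | inj₁ wc = wc
    ... | inj₂ ¬wc = ⊥-elim (none (w , w≢c , ¬wc))

  module FarPendant {p : Fin n} (p∈P : inP p ≡ true) (¬pu : A p u ≡ false) where
    q : Fin n
    q = parent p

    q∈T : inT q ≡ true
    q∈T = parent-inT p∈P

    pq : A p q ≡ true
    pq = parent-adj p∈P

    q≢u : q ≢ u
    q≢u q≡u = true≢false (subst (λ t → A p t ≡ true) q≡u pq) ¬pu

    p≢u : p ≢ u
    p≢u = inP⇒≢u p∈P

    q∈P : inP q ≡ true
    q∈P = inP-intro q∈T q≢u

    open ParentPendant p∈P using (∑f*<∑f-via-M; ∑f*<∑f-via-u; ∑f*<∑f-via-T)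

    -- Some pendant term is strict at w: for p if d(p , w) ≥ 2 (which holds when w ~ u, since T has
    -- no 4-cycle), otherwise for q, whose parent is u.
    module NonNeighbourOfq (qu : A q u ≡ true) {w : Fin n} (w∈T : inT w ≡ true) (w≢q : w ≢ q)
                           (¬wq : A w q ≡ false) where
      w≢u : w ≢ u
      w≢u refl = true≢false (trans (symm u q) qu) ¬wq

      w≢p : w ≢ p
      w≢p refl = true≢false pq ¬wq

      d-qw-≥2 : 2 ≤ d q w
      d-qw-≥2 = d-≥2 (w≢q ∘ sym) (λ qw → true≢false (trans (symm w q) qw) ¬wq)

      d-pw-≥2 : A w u ≡ true ⊎ A w p ≡ false → 2 ≤ d p w
      d-pw-≥2 (inj₁ wu) = d-≥2 (w≢p ∘ sym) (λ pw → no-square u-inT q∈T (inP⇒inT p∈P) w∈T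
        (q≢u ∘ sym) (p≢u ∘ sym) (w≢u ∘ sym) (adj⇒≢ pq ∘ sym) (w≢q ∘ sym) (w≢p ∘ sym)
        (trans (symm u q) qu) (trans (symm q p) pq) pw wu)
      d-pw-≥2 (inj₂ ¬wp) = d-≥2 (w≢p ∘ sym) (λ pw → true≢false (trans (symm w p) pw) ¬wp)

      parent-q≡u : parent q ≡ u
      parent-q≡u = parent-of-u-neighbour q∈P qu

      d-parent-q-w-≥2 : A w u ≡ false → 2 ≤ d (parent q) w
      d-parent-q-w-≥2 ¬wu = subst (λ t → 2 ≤ d t w) (sym parent-q≡u)
        (d-≥2 (w≢u ∘ sym) (λ uw → true≢false (trans (symm w u) uw) ¬wu))

      strict : DD* < DD
      strict with bool-cases (A w u) | bool-cases (A w p)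
      ... | inj₁ wu | _ =
        ∑f*<∑f⇒DD*<DD p∈P (∑f*<∑f-via-T w∈T w≢u w≢q (+-mono-≤ (d-pw-≥2 (inj₁ wu)) d-qw-≥2))
      ... | inj₂ _ | inj₂ ¬wp =
        ∑f*<∑f⇒DD*<DD p∈P (∑f*<∑f-via-T w∈T w≢u w≢q (+-mono-≤ (d-pw-≥2 (inj₂ ¬wp)) d-qw-≥2))
      ... | inj₂ ¬wu | inj₁ _ = ∑f*<∑f⇒DD*<DD q∈P (ParentPendant.∑f*<∑f-via-T q∈P w∈T w≢u
        (w≢u ∘ flip trans parent-q≡u) (+-mono-≤ d-qw-≥2 (d-parent-q-w-≥2 ¬wu)))

    -- With M = {u} all of G lies in T; if d(p , u) + d(q , u) ≤ 3 then q ~ u, and unless T is a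
    -- star at q (then G ≅ G* by swapping u and q) some vertex is not adjacent to q.
    strict-if-M-trivial : (∀ x → inM x ≡ true → x ≡ u) → DD* < DD
    strict-if-M-trivial M⇒u with 4 ≤? d p u + d q u
    ... | yes far = ∑f*<∑f⇒DD*<DD p∈P (∑f*<∑f-via-u q≢u far)
    ... | no ¬far with star-or-non-neighbour q
    ...   | inj₁ star = ⊥-elim (G≇G* (StarAt.iso-by-swap M⇒u q∈P star))
    ...   | inj₂ (w , w≢q , ¬wq) = NonNeighbourOfq.strict qu (all-in-T M⇒u w) w≢q ¬wq
      where
      d-qu-≤1 : d q u ≤ 1
      d-qu-≤1 = ≤-pred (≰⇒> (λ 2≤ → ¬far (+-mono-≤ (d-≥2 p≢u (λ pu → true≢false pu ¬pu)) 2≤)))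
      qu : A q u ≡ true
      qu = d≤1⇒adj q≢u d-qu-≤1

    strict : DD* < DD
    strict with Fin.any? (λ m → (inM m Bool.≟ true) ×-dec ¬? (m ≟ u))
    ... | yes (m , m∈M , m≢u) = ∑f*<∑f⇒DD*<DD p∈P (∑f*<∑f-via-M q≢u m∈M m≢u)
    ... | no none = strict-if-M-trivial M⇒u
      where
      M⇒u : ∀ x → inM x ≡ true → x ≡ u
      M⇒u x x∈M with x ≟ u
      ... | yes x≡u = x≡u
      ... | no x≢u = ⊥-elim (none (x , x∈M , x≢u))

  DD*<DD : DD* < DD
  DD*<DD with Fin.any? (λ p → (inP p Bool.≟ true) ×-dec (A p u Bool.≟ false))
  ... | yes (p , p∈P , ¬pu) = FarPendant.strict p∈P ¬pu
  ... | no none = ⊥-elim (G≇G* (iso-if-T-star-at-u star))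
    where
    star : ∀ p → inP p ≡ true → A p u ≡ true
    star p p∈P with bool-cases (A p u)
    ... | inj₁ pu = pu
    ... | inj₂ ¬pu = ⊥-elim (none (p , p∈P , ¬pu))

lemma1 : ∀ {n} (A : Graph n) (g : Gluing A) →
    ((∣ Gluing.N g ∣ ≡ 1) → ¬ Isomorphic A (gStar g) →
    degreeDistance (gStar g) < degreeDistance A)
    × (3 ≤ ∣ Gluing.M g ∣ → 3 ≤ ∣ Gluing.N g ∣ →
    degreeDistance (gStar g) < degreeDistance A)
lemma1 A g =
    (λ ∣N∣≡1 G≇G* → DD*<DD⇒ (SingletonN-NonIsomorphic.DD*<DD A g ∣N∣≡1 G≇G*))
  , (λ 3≤∣M∣ 3≤∣N∣ → DD*<DD⇒ (DD*<DD-if-M-and-N-large 3≤∣M∣ 3≤∣N∣))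
  where open Configuration A g using (DD*<DD⇒; DD*<DD-if-M-and-N-large)
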